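{- Let $q$ be a power of a prime $p\ge5$ and $\lambda\in\mathbb{F}_q\setminus\{0,1\}$ with $j(E^{\mathrm{Leg}}_\lambda)\notin\{0,1728\}$. Then $$|L(\lambda)|=\begin{cases}3 & \text{if } q\equiv3\pmod4,\\ 6 & \text{if } q\equiv1\pmod4 \text{ and both } \lambda,\,1-\lambda \text{ are squares in } \mathbb{F}_q,\\ 4 & \text{if } q\equiv1\pmod4 \text{ and exactly one of } \lambda,\,1-\lambda \text{ is a square in }\mathbb{F}_q,\\ 2 & \text{if } q\equiv1\pmod4 \text{ and neither } \lambda \text{ nor } 1-\lambda \text{ is a square in } \mathbb{F}_q.\end{cases}$$
   Context: For $\lambda\in\mathbb{F}_q\setminus\{0,1\}$, $E^{\mathrm{Leg}}_\lambda$ is the Legendre elliptic curve $y^2=x(x-1)(x-\lambda)$, with $j$-invariant $j(E^{\mathrm{Leg}}_\lambda)=2^8(\lambda^2-\lambda+1)^3/(\lambda^2(\lambda-1)^2)$. Define $L(\lambda):=\{\beta\in\mathbb{F}_q\setminus\{0,1\}:\ E^{\mathrm{Leg}}_\beta\cong E^{\mathrm{Leg}}_\lambda \text{ over } \mathbb{F}_q\}$. -}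

module Defs where

open import Level using (0ℓ)
open import Data.Nat as ℕ using (ℕ; zero; suc)
open import Data.List using (List; length)
open import Data.List.Membership.Propositional using (_∈_)
open import Data.List.Relation.Unary.Unique.Propositional using (Unique)
open import Data.Product using (Σ; ∃; _×_; _,_)
open import Relation.Binary.PropositionalEquality using (_≡_; _≢_)
open import Relation.Binary.Definitions using (DecidableEquality)
open import Algebra.Structures using (IsCommutativeRing)
open import Function.Bundles using (_⇔_)

-- The inverse is a total function, specified only on nonzero elements.
record FiniteField : Set₁ where
  infixl 6 _+_ _-_
  infixl 7 _*_
  field
    F        : Set
    _+_ _*_  : F → F → F
    -_       : F → F
    0# 1#    : F
    isCommutativeRing : IsCommutativeRing _≡_ _+_ _*_ -_ 0# 1#
    0≢1      : 0# ≢ 1#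
    _⁻¹      : F → F
    inverseʳ : ∀ x → x ≢ 0# → x * (x ⁻¹) ≡ 1#
    _≟_      : DecidableEquality F
    elements : List F
    elements-unique   : Unique elements
    elements-complete : ∀ x → x ∈ elements

  _-_ : F → F → F
  x - y = x + (- y)

  size : ℕ
  size = length elements

  ι : ℕ → F
  ι zero    = 0#
  ι (suc n) = 1# + ι n

  _^_ : F → ℕ → F
  x ^ zero  = 1#
  x ^ suc n = x * (x ^ n)

  IsSquare : F → Set
  IsSquare x = ∃ λ y → y * y ≡ x

  -- Weierstrass equation y² + a1 xy + a3 y = x³ + a2 x² + a4 x + a6
  record Weierstrass : Set where
    constructor weier
    field a1 a2 a3 a4 a6 : F

  -- Legendre curve y² = x(x-1)(x-λ) = x³ - (1+λ) x² + λ x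
  Leg : F → Weierstrass
  Leg l = weier 0# (- (1# + l)) 0# l 0#

  -- Isomorphism over F of Weierstrass equations (Silverman, Table 3.1):
  -- an admissible change of variables x = u²x' + r, y = u³y' + su²x' + t, u ≠ 0,
  -- transforming E into E'.
  _≅_ : Weierstrass → Weierstrass → Set
  E ≅ E' =
    let open Weierstrass E
        open Weierstrass E' renaming (a1 to b1; a2 to b2; a3 to b3; a4 to b4; a6 to b6)
    in Σ F λ u → Σ F λ r → Σ F λ s → Σ F λ t →
         (u ≢ 0#)
       × (u * b1 ≡ a1 + ι 2 * s)
       × ((u ^ 2) * b2 ≡ a2 - s * a1 + ι 3 * r - s ^ 2)
       × ((u ^ 3) * b3 ≡ a3 + r * a1 + ι 2 * t)
       × ((u ^ 4) * b4 ≡ a4 - s * a3 + ι 2 * r * a2 - (t + r * s) * a1 + ι 3 * (r ^ 2) - ι 2 * s * t)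
       × ((u ^ 6) * b6 ≡ a6 + r * a4 + (r ^ 2) * a2 + r ^ 3 - t * a3 - t ^ 2 - r * t * a1)

  jLeg : F → F
  jLeg l = ι 256 * ((l ^ 2 - l + 1#) ^ 3) * (((l ^ 2) * ((l - 1#) ^ 2)) ⁻¹)

  L : F → F → Set
  L l β = (β ≢ 0#) × (β ≢ 1#) × (Leg β ≅ Leg l)

  HasCard : (F → Set) → ℕ → Set
  HasCard P n = Σ (List F) λ xs → Unique xs × (length xs ≡ n) × (∀ x → (x ∈ xs) ⇔ P x)

module Submission where

-- With a₁ = a₃ = 0 on both curves and 2 invertible (2 divides the numerator 2⁸ of j, and
-- j(λ) ≠ 0), an isomorphism Leg β ≅ Leg λ is x ↦ u²x + r, y ↦ u³y with r ∈ {0, 1, β} a root of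
-- x(x - 1)(x - β). In each of the three cases the two remaining coefficient equations factor,
-- and β is one of λ, 1 - λ, 1/λ, 1 - 1/λ, λ/(λ - 1), 1/(1 - λ), realised exactly when
-- (respectively) always, -1, λ, -λ, 1 - λ, λ - 1 is a square. Two of these values coincide only
-- if λ² - λ + 1 = 0 (j = 0) or (λ + 1)(λ - 2)(2λ - 1) = 0 (j = 1728), so the six are distinct.
-- Euler's criterion, proved by Wilson's pairing of each unit x with a/x in the product of all
-- units, shows that -1 is a square iff q ≡ 1 (mod 4), and that for q ≡ 3 (mod 4) exactly one of
-- x, -x is a square. Hence |L(λ)| = 1 + 0 + 1 + 1 = 3 when q ≡ 3 (mod 4), and
-- |L(λ)| = 2 (1 + [λ is a square] + [1 - λ is a square]) when q ≡ 1 (mod 4).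

open import Defs
open import Level using (Level; 0ℓ)
open import Algebra.Bundles using (CommutativeRing)
open import Algebra.Solver.Ring.AlmostCommutativeRing using (fromCommutativeRing; _-Raw-AlmostCommutative⟶_)
import Data.Nat
open import Data.Nat as ℕ using (ℕ; zero; suc; _≤_)
import Data.Nat.Properties as ℕ
open import Data.Nat.DivMod using (_%_; _/_; m≡m%n+[m/n]*n)
open import Data.Nat.Primality using (Prime)
import Data.Integer as ℤ
import Data.Integer.Properties as ℤ
open import Data.Sign as Sign using (Sign)
open import Data.Bool using (if_then_else_)
open import Data.Maybe using (Maybe; just; nothing)
open import Data.Unit using (tt)
open import Data.Empty using (⊥; ⊥-elim)
open import Data.Product using (Σ; _×_; _,_; proj₁; proj₂)
open import Data.Sum as Sum using (_⊎_; inj₁; inj₂; [_,_]′)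
open import Data.List using (List; []; _∷_; length; map; foldr; filter)
open import Data.List.Properties using (filter-accept; filter-reject; filter-all)
open import Data.List.Relation.Unary.Any using (any?; here; there; satisfied)
import Data.List.Relation.Unary.All as All
open import Data.List.Relation.Unary.All using ([]; _∷_)
open import Data.List.Relation.Unary.AllPairs using ([]; _∷_)
open import Data.List.Membership.Propositional using (_∈_; lose)
open import Data.List.Membership.Propositional.Properties using (∈-filter⁺; ∈-filter⁻)
open import Data.List.Relation.Unary.Unique.Propositional using (Unique)
import Data.List.Relation.Unary.Unique.Propositional.Properties as Unique
open import Function.Base using (_∘_; _∘′_)
open import Function.Bundles using (_⇔_; mk⇔; Equivalence)
import Function.Properties.Equivalence as ⇔
open import Relation.Nullary using (¬_; Dec; yes; no; does; ¬?)
open import Relation.Nullary.Decidable using (map′)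
open import Relation.Binary.PropositionalEquality
  using (_≡_; _≢_; refl; sym; trans; cong; cong₂; subst; ≢-sym; module ≡-Reasoning)

module IntegerCoefficientSolver {c ℓ : Level} (R : CommutativeRing c ℓ) where

  open import Data.Integer using (ℤ; +_; -[1+_])

  open CommutativeRing R hiding (refl; sym; trans)
  open CommutativeRing R using () renaming (refl to ≈-refl; sym to ≈-sym; trans to ≈-trans)
  open import Algebra.Properties.Semiring.Mult semiring using (×-homo-+; ×1-homo-*) renaming (_×_ to _·_)
  open import Algebra.Properties.Ring ring using (-‿involutive; -‿+-comm; -0#≈0#; -1*x≈-x)
  open import Algebra.Properties.CommutativeSemigroup *-commutativeSemigroup using (interchange)
  open import Relation.Binary.Reasoning.Setoid setoid

  ⟦_⟧· : ℤ → Carrier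
  ⟦ + n ⟧·     = n · 1#
  ⟦ -[1+ n ] ⟧· = - (suc n · 1#)

  ⟦⊖⟧ : ∀ m n → ⟦ m ℤ.⊖ n ⟧· ≈ m · 1# - n · 1#
  ⟦⊖⟧ zero    zero    = ≈-sym (≈-trans (+-identityˡ _) -0#≈0#)
  ⟦⊖⟧ zero    (suc n) = ≈-sym (+-identityˡ _)
  ⟦⊖⟧ (suc m) zero    = ≈-sym (≈-trans (+-congˡ -0#≈0#) (+-identityʳ _))
  ⟦⊖⟧ (suc m) (suc n) = begin
    ⟦ suc m ℤ.⊖ suc n ⟧·            ≡⟨ cong ⟦_⟧· (ℤ.[1+m]⊖[1+n]≡m⊖n m n) ⟩
    ⟦ m ℤ.⊖ n ⟧·                    ≈⟨ ⟦⊖⟧ m n ⟩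
    m · 1# - n · 1#                 ≈⟨ cancel-1 ⟨
    (1# + m · 1#) - (1# + n · 1#)   ∎
    where
    cancel-1 : (1# + m · 1#) - (1# + n · 1#) ≈ m · 1# - n · 1#
    cancel-1 = begin
      (1# + m · 1#) + - (1# + n · 1#)       ≈⟨ +-congˡ (-‿+-comm 1# (n · 1#)) ⟨
      (1# + m · 1#) + (- 1# + - (n · 1#))   ≈⟨ +-congʳ (+-comm 1# _) ⟩
      (m · 1# + 1#) + (- 1# + - (n · 1#))   ≈⟨ +-assoc _ _ _ ⟩
      m · 1# + (1# + (- 1# + - (n · 1#)))   ≈⟨ +-congˡ (+-assoc _ _ _) ⟨
      m · 1# + ((1# + - 1#) + - (n · 1#))   ≈⟨ +-congˡ (+-congʳ (-‿inverseʳ 1#)) ⟩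
      m · 1# + (0# + - (n · 1#))            ≈⟨ +-congˡ (+-identityˡ _) ⟩
      m · 1# - n · 1#                       ∎

  ⟦+⟧ : ∀ i j → ⟦ i ℤ.+ j ⟧· ≈ ⟦ i ⟧· + ⟦ j ⟧·
  ⟦+⟧ (+ m)    (+ n)    = ×-homo-+ 1# m n
  ⟦+⟧ (+ m)    -[1+ n ] = ⟦⊖⟧ m (suc n)
  ⟦+⟧ -[1+ m ] (+ n)    = ≈-trans (⟦⊖⟧ n (suc m)) (+-comm _ _)
  ⟦+⟧ -[1+ m ] -[1+ n ] = begin
    - (suc (suc m ℕ.+ n) · 1#)           ≈⟨ -‿cong (+-congˡ (×-homo-+ 1# (suc m) n)) ⟩
    - (1# + (suc m · 1# + n · 1#))        ≈⟨ -‿cong (+-assoc _ _ _) ⟨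
    - ((1# + suc m · 1#) + n · 1#)        ≈⟨ -‿cong (+-congʳ (+-comm _ _)) ⟩
    - ((suc m · 1# + 1#) + n · 1#)        ≈⟨ -‿cong (+-assoc _ _ _) ⟩
    - (suc m · 1# + suc n · 1#)           ≈⟨ -‿+-comm _ _ ⟨
    - (suc m · 1#) + - (suc n · 1#)       ∎

  ⟦-⟧ : ∀ i → ⟦ ℤ.- i ⟧· ≈ - ⟦ i ⟧·
  ⟦-⟧ (+ zero)  = ≈-sym -0#≈0#
  ⟦-⟧ (+ suc n) = ≈-refl
  ⟦-⟧ -[1+ n ]  = ≈-sym (-‿involutive _)

  ⟦_⟧ₛ : Sign → Carrier
  ⟦ Sign.+ ⟧ₛ = 1#
  ⟦ Sign.- ⟧ₛ = - 1#

  ⟦*⟧ₛ : ∀ s t → ⟦ s Sign.* t ⟧ₛ ≈ ⟦ s ⟧ₛ * ⟦ t ⟧ₛ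
  ⟦*⟧ₛ Sign.+ t      = ≈-sym (*-identityˡ _)
  ⟦*⟧ₛ Sign.- Sign.+ = ≈-sym (*-identityʳ _)
  ⟦*⟧ₛ Sign.- Sign.- = ≈-sym (≈-trans (-1*x≈-x (- 1#)) (-‿involutive 1#))

  ⟦◃⟧ : ∀ s n → ⟦ s ℤ.◃ n ⟧· ≈ ⟦ s ⟧ₛ * (n · 1#)
  ⟦◃⟧ s      zero    = ≈-sym (zeroʳ _)
  ⟦◃⟧ Sign.+ (suc n) = ≈-sym (*-identityˡ _)
  ⟦◃⟧ Sign.- (suc n) = ≈-sym (-1*x≈-x _)

  ⟦sign*abs⟧ : ∀ i → ⟦ i ⟧· ≈ ⟦ ℤ.sign i ⟧ₛ * (ℤ.∣ i ∣ · 1#)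
  ⟦sign*abs⟧ (+ n)    = ≈-sym (*-identityˡ _)
  ⟦sign*abs⟧ -[1+ n ] = ≈-sym (-1*x≈-x _)

  ⟦*⟧ : ∀ i j → ⟦ i ℤ.* j ⟧· ≈ ⟦ i ⟧· * ⟦ j ⟧·
  ⟦*⟧ i j = begin
    ⟦ (s Sign.* t) ℤ.◃ (m ℕ.* n) ⟧·        ≈⟨ ⟦◃⟧ (s Sign.* t) (m ℕ.* n) ⟩
    ⟦ s Sign.* t ⟧ₛ * ((m ℕ.* n) · 1#)     ≈⟨ *-cong (⟦*⟧ₛ s t) (×1-homo-* m n) ⟩
    (⟦ s ⟧ₛ * ⟦ t ⟧ₛ) * (m · 1# * n · 1#)  ≈⟨ interchange _ _ _ _ ⟩
    (⟦ s ⟧ₛ * m · 1#) * (⟦ t ⟧ₛ * n · 1#)  ≈⟨ *-cong (⟦sign*abs⟧ i) (⟦sign*abs⟧ j) ⟨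
    ⟦ i ⟧· * ⟦ j ⟧·                        ∎
    where
    s = ℤ.sign i
    t = ℤ.sign j
    m = ℤ.∣ i ∣
    n = ℤ.∣ j ∣

  -- The homomorphism laws are proved above for n · 1#, but the coefficient map handed to the
  -- solver sends + 1 to 1# on the nose (n · 1# gives 1# + 0#), so that 1# can be written as the
  -- constant :1 in solver goals.
  ⟦_⟧ℕ : ℕ → Carrier
  ⟦ zero ⟧ℕ        = 0#
  ⟦ suc zero ⟧ℕ    = 1#
  ⟦ suc (suc n) ⟧ℕ = 1# + ⟦ suc n ⟧ℕ

  ⟦_⟧ℤ : ℤ → Carrier
  ⟦ + n ⟧ℤ      = ⟦ n ⟧ℕ
  ⟦ -[1+ n ] ⟧ℤ = - ⟦ suc n ⟧ℕ

  ⟦⟧ℕ≈· : ∀ n → ⟦ n ⟧ℕ ≈ n · 1#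
  ⟦⟧ℕ≈· zero          = ≈-refl
  ⟦⟧ℕ≈· (suc zero)    = ≈-sym (+-identityʳ 1#)
  ⟦⟧ℕ≈· (suc (suc n)) = +-congˡ (⟦⟧ℕ≈· (suc n))

  ⟦⟧ℤ≈⟦⟧· : ∀ i → ⟦ i ⟧ℤ ≈ ⟦ i ⟧·
  ⟦⟧ℤ≈⟦⟧· (+ n)    = ⟦⟧ℕ≈· n
  ⟦⟧ℤ≈⟦⟧· -[1+ n ] = -‿cong (⟦⟧ℕ≈· (suc n))

  ℤ-morphism : CommutativeRing.rawRing ℤ.+-*-commutativeRing -Raw-AlmostCommutative⟶ fromCommutativeRing R
  ℤ-morphism = record
    { ⟦_⟧    = ⟦_⟧ℤ
    ; +-homo = λ i j → homo₂ (i ℤ.+ j) i j _+_ +-cong (⟦+⟧ i j)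
    ; *-homo = λ i j → homo₂ (i ℤ.* j) i j _*_ *-cong (⟦*⟧ i j)
    ; -‿homo = λ i → ≈-trans (⟦⟧ℤ≈⟦⟧· (ℤ.- i)) (≈-trans (⟦-⟧ i) (-‿cong (≈-sym (⟦⟧ℤ≈⟦⟧· i))))
    ; 0-homo = ≈-refl
    ; 1-homo = ≈-refl
    }
    where
    homo₂ : ∀ k i j (_∙_ : Carrier → Carrier → Carrier) →
            (∀ {a b c d} → a ≈ b → c ≈ d → (a ∙ c) ≈ (b ∙ d)) →
            ⟦ k ⟧· ≈ ⟦ i ⟧· ∙ ⟦ j ⟧· → ⟦ k ⟧ℤ ≈ ⟦ i ⟧ℤ ∙ ⟦ j ⟧ℤ
    homo₂ k i j _ ∙-cong eq =
      ≈-trans (⟦⟧ℤ≈⟦⟧· k) (≈-trans eq (∙-cong (≈-sym (⟦⟧ℤ≈⟦⟧· i)) (≈-sym (⟦⟧ℤ≈⟦⟧· j))))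

  _≟ℤ_ : ∀ i j → Maybe (⟦ i ⟧ℤ ≈ ⟦ j ⟧ℤ)
  i ≟ℤ j with i ℤ.≟ j
  ... | yes refl = just ≈-refl
  ... | no _       = nothing

  open import Algebra.Solver.Ring (CommutativeRing.rawRing ℤ.+-*-commutativeRing) (fromCommutativeRing R) ℤ-morphism _≟ℤ_ public

module FieldProperties (K : FiniteField) where

  open FiniteField K

  commutativeRing : CommutativeRing 0ℓ 0ℓ
  commutativeRing = record
    { Carrier = F ; _≈_ = _≡_ ; _+_ = _+_ ; _*_ = _*_ ; -_ = -_ ; 0# = 0# ; 1# = 1#
    ; isCommutativeRing = isCommutativeRing }

  open CommutativeRing commutativeRing public
    using (+-identityˡ; +-identityʳ; *-assoc; *-comm; *-identityˡ; *-identityʳ; zeroˡ; zeroʳ; -‿inverseʳ)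
  open import Algebra.Properties.Ring (CommutativeRing.ring commutativeRing) public
    using (-‿involutive; -‿injective; -0#≈0#; x∙y⁻¹≈ε⇒x≈y; x≈y⇒x∙y⁻¹≈ε)
  open IntegerCoefficientSolver commutativeRing public
    using (Polynomial; solve; _:=_; _:+_; _:*_; :-_; _:-_; con)

  :0 :1 : ∀ {n} → Polynomial n
  :0 = con (ℤ.+ 0)
  :1 = con (ℤ.+ 1)

  -- :ι k evaluates to ι k itself (needed wherever ι occurs in a goal); :κ k is a plain
  -- coefficient, cheaper for the solver to normalise.
  :ι : ∀ {n} → ℕ → Polynomial n
  :ι zero    = :0
  :ι (suc k) = :1 :+ :ι k

  :κ : ∀ {n} → ℕ → Polynomial n
  :κ k = con (ℤ.+ k)

  x-y≡0⇒x≡y : ∀ {x y} → x - y ≡ 0# → x ≡ y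
  x-y≡0⇒x≡y = x∙y⁻¹≈ε⇒x≈y _ _

  x≡y⇒x-y≡0 : ∀ {x y} → x ≡ y → x - y ≡ 0#
  x≡y⇒x-y≡0 = x≈y⇒x∙y⁻¹≈ε

  -- Most equations below are derived by exhibiting the difference of their two sides as an
  -- explicit combination of the differences of the hypotheses; the solver checks the combination.
  vanishes₁ : ∀ {a b x k} → a ≡ b → x ≡ k * (a - b) → x ≡ 0#
  vanishes₁ {k = k} a≡b eq = trans eq (trans (cong (k *_) (x≡y⇒x-y≡0 a≡b)) (zeroʳ k))

  vanishes₂ : ∀ {a b c d x k₁ k₂} → a ≡ b → c ≡ d → x ≡ k₁ * (a - b) + k₂ * (c - d) → x ≡ 0#
  vanishes₂ a≡b c≡d eq =
    trans eq (trans (cong₂ _+_ (vanishes₁ a≡b refl) (vanishes₁ c≡d refl)) (+-identityˡ 0#))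

  vanishes₃ : ∀ {a b c d e f x k₁ k₂ k₃} → a ≡ b → c ≡ d → e ≡ f →
              x ≡ k₁ * (a - b) + k₂ * (c - d) + k₃ * (e - f) → x ≡ 0#
  vanishes₃ a≡b c≡d e≡f eq =
    trans eq (trans (cong₂ _+_ (vanishes₂ a≡b c≡d refl) (vanishes₁ e≡f refl)) (+-identityˡ 0#))

  1≢0 : 1# ≢ 0#
  1≢0 eq = 0≢1 (sym eq)

  x*y≡0⇒x≡0⊎y≡0 : ∀ {x y} → x * y ≡ 0# → x ≡ 0# ⊎ y ≡ 0#
  x*y≡0⇒x≡0⊎y≡0 {x} {y} xy≡0 with x ≟ 0#
  ... | yes x≡0 = inj₁ x≡0
  ... | no  x≢0 = inj₂ (vanishes₂ xy≡0 (inverseʳ x x≢0)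
    (solve 3 (λ x y x⁻¹ → y := x⁻¹ :* (x :* y :- :0) :+ (:- y) :* (x :* x⁻¹ :- :1)) refl x y (x ⁻¹)))

  *-≢0 : ∀ {x y} → x ≢ 0# → y ≢ 0# → x * y ≢ 0#
  *-≢0 x≢0 y≢0 xy≡0 with x*y≡0⇒x≡0⊎y≡0 xy≡0
  ... | inj₁ x≡0 = x≢0 x≡0
  ... | inj₂ y≡0 = y≢0 y≡0

  *-cancelˡ-≡0 : ∀ {k x} → k ≢ 0# → k * x ≡ 0# → x ≡ 0#
  *-cancelˡ-≡0 k≢0 kx≡0 with x*y≡0⇒x≡0⊎y≡0 kx≡0
  ... | inj₁ k≡0 = ⊥-elim (k≢0 k≡0)
  ... | inj₂ x≡0 = x≡0

  -‿≢0 : ∀ {x} → x ≢ 0# → - x ≢ 0#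
  -‿≢0 {x} x≢0 -x≡0 = x≢0 (trans (sym (-‿involutive x)) (trans (cong -_ -x≡0) -0#≈0#))

  x+y≡0⇒x≡-y : ∀ {x y} → x + y ≡ 0# → x ≡ - y
  x+y≡0⇒x≡-y {x} {y} x+y≡0 = x-y≡0⇒x≡y (trans (cong (x +_) (-‿involutive y)) x+y≡0)

  inverseˡ : ∀ x → x ≢ 0# → x ⁻¹ * x ≡ 1#
  inverseˡ x x≢0 = trans (*-comm _ _) (inverseʳ x x≢0)

  ⁻¹-unique : ∀ {x y} → x * y ≡ 1# → y ≡ x ⁻¹
  ⁻¹-unique {x} {y} xy≡1 = x-y≡0⇒x≡y (vanishes₂ xy≡1 (inverseʳ x x≢0)
    (solve 3 (λ x y x⁻¹ → y :- x⁻¹ := x⁻¹ :* (x :* y :- :1) :+ (:- y) :* (x :* x⁻¹ :- :1)) refl x y (x ⁻¹)))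
    where
    x≢0 : x ≢ 0#
    x≢0 x≡0 = 0≢1 (trans (sym (zeroˡ y)) (trans (cong (_* y) (sym x≡0)) xy≡1))

  ⁻¹-≢0 : ∀ {x} → x ≢ 0# → x ⁻¹ ≢ 0#
  ⁻¹-≢0 {x} x≢0 x⁻¹≡0 = 0≢1 (trans (sym (zeroʳ x)) (trans (cong (x *_) (sym x⁻¹≡0)) (inverseʳ x x≢0)))

  ⁻¹-involutive : ∀ {x} → x ≢ 0# → (x ⁻¹) ⁻¹ ≡ x
  ⁻¹-involutive {x} x≢0 = sym (⁻¹-unique (inverseˡ x x≢0))

  y²≡x⇒x≢0⇒y≢0 : ∀ {x y} → y * y ≡ x → x ≢ 0# → y ≢ 0#
  y²≡x⇒x≢0⇒y≢0 {x} {y} y²≡x x≢0 y≡0 = x≢0 (trans (sym y²≡x) (trans (cong (_* y) y≡0) (zeroˡ y)))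

  y²*[y⁻¹]²≡1 : ∀ {y} → y ≢ 0# → (y * y) * (y ⁻¹ * y ⁻¹) ≡ 1#
  y²*[y⁻¹]²≡1 {y} y≢0 = x-y≡0⇒x≡y (vanishes₁ (inverseʳ y y≢0)
    (solve 2 (λ y y⁻¹ → (y :* y) :* (y⁻¹ :* y⁻¹) :- :1 := (y :* y⁻¹ :+ :1) :* (y :* y⁻¹ :- :1)) refl y (y ⁻¹)))

  IsSquare-⁻¹ : ∀ {x y} → (y * y) * x ≡ 1# → IsSquare x
  IsSquare-⁻¹ {x} {y} y²x≡1 = y ⁻¹ , trans (⁻¹-unique (y²*[y⁻¹]²≡1 y≢0)) (sym (⁻¹-unique y²x≡1))
    where
    y≢0 : y ≢ 0#
    y≢0 y≡0 = 0≢1 (trans (sym (trans (cong (λ z → (z * z) * x) y≡0) (trans (cong (_* x) (zeroˡ 0#)) (zeroˡ x)))) y²x≡1)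

  y²≡x⇒[y⁻¹]²x≡1 : ∀ {x y} → y * y ≡ x → x ≢ 0# → (y ⁻¹ * y ⁻¹) * x ≡ 1#
  y²≡x⇒[y⁻¹]²x≡1 {x} {y} y²≡x x≢0 =
    trans (cong ((y ⁻¹ * y ⁻¹) *_) (sym y²≡x)) (trans (*-comm _ _) (y²*[y⁻¹]²≡1 (y²≡x⇒x≢0⇒y≢0 y²≡x x≢0)))

  Admissible : F → Set
  Admissible x = x ≢ 0# × x ≢ 1#

  1-‿admissible : ∀ {x} → Admissible x → Admissible (1# - x)
  1-‿admissible {x} (x≢0 , x≢1) =
    (λ 1-x≡0 → x≢1 (sym (x-y≡0⇒x≡y 1-x≡0))) ,
    (λ 1-x≡1 → x≢0 (x-y≡0⇒x≡y (vanishes₁ 1-x≡1 (solve 1 (λ x → x :- :0 := (:- :1) :* ((:1 :- x) :- :1)) refl x))))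

  ⁻¹-admissible : ∀ {x} → Admissible x → Admissible (x ⁻¹)
  ⁻¹-admissible {x} (x≢0 , x≢1) =
    ⁻¹-≢0 x≢0 ,
    (λ x⁻¹≡1 → x≢1 (trans (sym (⁻¹-involutive x≢0)) (trans (cong _⁻¹ x⁻¹≡1) (sym (⁻¹-unique (*-identityˡ 1#))))))

module SquareProperties (K : FiniteField) where

  open FiniteField K
  open FieldProperties K

  IsSquare? : ∀ x → Dec (IsSquare x)
  IsSquare? x = map′ satisfied (λ (y , y²≡x) → lose (elements-complete y) y²≡x)
                     (any? (λ y → (y * y) ≟ x) elements)

  IsSquare-* : ∀ {x y} → IsSquare x → IsSquare y → IsSquare (x * y)
  IsSquare-* {x} {y} (a , a²≡x) (b , b²≡y) = a * b , x-y≡0⇒x≡y (vanishes₂ a²≡x b²≡y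
    (solve 4 (λ a b x y → (a :* b) :* (a :* b) :- x :* y := (b :* b) :* (a :* a :- x) :+ x :* (b :* b :- y))
      refl a b x y))

  IsSquare-neg : ∀ {x} → IsSquare (- 1#) → IsSquare x → IsSquare (- x)
  IsSquare-neg {x} □-1 □x =
    let (y , y²≡-1*x) = IsSquare-* □-1 □x in y , trans y²≡-1*x (solve 1 (λ x → :- :1 :* x := :- x) refl x)

  IsSquare-neg⁻ : ∀ {x} → IsSquare (- 1#) → IsSquare (- x) → IsSquare x
  IsSquare-neg⁻ {x} □-1 □-x = let (y , y²≡--x) = IsSquare-neg □-1 □-x in y , trans y²≡--x (-‿involutive x)

  IsSquare-both⇒IsSquare[-1] : ∀ {x} → x ≢ 0# → IsSquare x → IsSquare (- x) → IsSquare (- 1#)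
  IsSquare-both⇒IsSquare[-1] {x} x≢0 (y , y²≡x) (z , z²≡-x) =
    z * y ⁻¹ , x-y≡0⇒x≡y (vanishes₃ y²≡x z²≡-x (inverseʳ y (y²≡x⇒x≢0⇒y≢0 y²≡x x≢0))
      (solve 4 (λ y z x y⁻¹ → (z :* y⁻¹) :* (z :* y⁻¹) :- (:- :1)
        := (y⁻¹ :* y⁻¹) :* (y :* y :- x) :+ (y⁻¹ :* y⁻¹) :* (z :* z :- (:- x))
           :+ ((:- :1) :- y :* y⁻¹) :* (y :* y⁻¹ :- :1)) refl y z x (y ⁻¹)))

module UnitProducts (K : FiniteField) where

  open FiniteField K
  open FieldProperties K

  remove : F → List F → List F
  remove y = filter (λ z → ¬? (z ≟ y))

  ∏ : List F → F
  ∏ = foldr _*_ 1#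

  ∈-remove⁺ : ∀ {x y xs} → x ∈ xs → x ≢ y → x ∈ remove y xs
  ∈-remove⁺ = ∈-filter⁺ (λ z → ¬? (z ≟ _))

  ∈-remove⁻ : ∀ {x y xs} → x ∈ remove y xs → x ∈ xs × x ≢ y
  ∈-remove⁻ = ∈-filter⁻ (λ z → ¬? (z ≟ _))

  remove-unique : ∀ {y xs} → Unique xs → Unique (remove y xs)
  remove-unique = Unique.filter⁺ (λ z → ¬? (z ≟ _))

  remove-head : ∀ {y ys} → Unique (y ∷ ys) → remove y (y ∷ ys) ≡ ys
  remove-head {y} (y∉ys ∷ _) =
    trans (filter-reject (λ z → ¬? (z ≟ y)) (λ y≢y → y≢y refl))
          (filter-all (λ z → ¬? (z ≟ y)) (All.map (λ y≢z z≡y → y≢z (sym z≡y)) y∉ys))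

  remove-cons : ∀ {y z zs} → z ≢ y → remove y (z ∷ zs) ≡ z ∷ remove y zs
  remove-cons {y} = filter-accept (λ z → ¬? (z ≟ y))

  length-remove : ∀ {y xs} → Unique xs → y ∈ xs → length xs ≡ suc (length (remove y xs))
  length-remove {xs = y ∷ ys} u (here refl) = cong (λ zs → suc (length zs)) (sym (remove-head {y} {ys} u))
  length-remove (z∉zs ∷ u) (there y∈zs) =
    trans (cong suc (length-remove u y∈zs))
          (cong (λ ws → suc (length ws)) (sym (remove-cons (All.lookup z∉zs y∈zs))))

  ∏-remove : ∀ {y xs} → Unique xs → y ∈ xs → ∏ xs ≡ y * ∏ (remove y xs)
  ∏-remove {xs = y ∷ ys} u (here refl) = cong (λ zs → y * ∏ zs) (sym (remove-head {y} {ys} u))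
  ∏-remove {y} (z∉zs ∷ u) (there {x = z} {xs = zs} y∈zs) = begin
    z * ∏ zs                   ≡⟨ cong (z *_) (∏-remove u y∈zs) ⟩
    z * (y * ∏ (remove y zs))  ≡⟨ solve 3 (λ z y p → z :* (y :* p) := y :* (z :* p)) refl z y _ ⟩
    y * (z * ∏ (remove y zs))  ≡⟨ cong (λ ws → y * ∏ ws) (sym (remove-cons (All.lookup z∉zs y∈zs))) ⟩
    y * ∏ (remove y (z ∷ zs))  ∎
    where open ≡-Reasoning

  ∈-uncons : ∀ {w x : F} {ys} → w ∈ x ∷ ys → w ≢ x → w ∈ ys
  ∈-uncons (here w≡x)  w≢x = ⊥-elim (w≢x w≡x)
  ∈-uncons (there w∈ys) _  = w∈ys

  record IsPairing (σ : F → F) (a : F) (xs : List F) : Set where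
    field
      closed       : ∀ {x} → x ∈ xs → σ x ∈ xs
      involutive   : ∀ {x} → x ∈ xs → σ (σ x) ≡ x
      fixed-free   : ∀ {x} → x ∈ xs → σ x ≢ x
      pair-product : ∀ {x} → x ∈ xs → x * σ x ≡ a

  ∏-pairing : ∀ {σ a} xs → Unique xs → IsPairing σ a xs →
              Σ ℕ λ n → length xs ≡ n ℕ.+ n × ∏ xs ≡ a ^ n
  ∏-pairing {σ} {a} xs = go (length xs) xs refl
    where
    go : ∀ m xs → length xs ≡ m → Unique xs → IsPairing σ a xs →
         Σ ℕ λ n → length xs ≡ n ℕ.+ n × ∏ xs ≡ a ^ n
    go zero          []           _ _ _ = 0 , refl , refl
    go (suc zero)    (x ∷ [])     _ _ p with IsPairing.closed p (here refl)
    ... | here σx≡x = ⊥-elim (IsPairing.fixed-free p (here refl) σx≡x)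
    go (suc (suc m)) (x ∷ ys) len (x∉ys ∷ ys-unique) p =
      suc n ,
      cong suc (trans (length-remove ys-unique σx∈ys) (trans (cong suc length-zs) (sym (ℕ.+-suc n n)))) ,
      (begin
        x * ∏ ys              ≡⟨ cong (x *_) (∏-remove ys-unique σx∈ys) ⟩
        x * (σ x * ∏ zs)      ≡⟨ sym (*-assoc x (σ x) (∏ zs)) ⟩
        (x * σ x) * ∏ zs      ≡⟨ cong₂ _*_ (pair-product (here refl)) ∏zs ⟩
        a * a ^ n             ∎)
      where
      open ≡-Reasoning
      open IsPairing p
      σx∈ys : σ x ∈ ys
      σx∈ys = ∈-uncons (closed (here refl)) (fixed-free (here refl))
      zs = remove (σ x) ys
      ∈zs⁻ : ∀ {z} → z ∈ zs → z ∈ ys × z ≢ σ x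
      ∈zs⁻ = ∈-remove⁻ {xs = ys}
      ∈zs⇒∈ys : ∀ {z} → z ∈ zs → z ∈ x ∷ ys
      ∈zs⇒∈ys z∈zs = there (proj₁ (∈zs⁻ z∈zs))
      closed-zs : ∀ {z} → z ∈ zs → σ z ∈ zs
      closed-zs {z} z∈zs = ∈-remove⁺ (∈-uncons (closed z∈) σz≢x) σz≢σx
        where
        z∈ = ∈zs⇒∈ys z∈zs
        σz≢x : σ z ≢ x
        σz≢x σz≡x = proj₂ (∈zs⁻ z∈zs) (trans (sym (involutive z∈)) (cong σ σz≡x))
        σz≢σx : σ z ≢ σ x
        σz≢σx σz≡σx = All.lookup x∉ys (proj₁ (∈zs⁻ z∈zs))
          (sym (trans (sym (involutive z∈)) (trans (cong σ σz≡σx) (involutive (here refl)))))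
      pairing-zs : IsPairing σ a zs
      pairing-zs = record
        { closed       = closed-zs
        ; involutive   = involutive ∘ ∈zs⇒∈ys
        ; fixed-free   = fixed-free ∘ ∈zs⇒∈ys
        ; pair-product = pair-product ∘ ∈zs⇒∈ys
        }
      rec = go m zs (ℕ.suc-injective (trans (sym (length-remove ys-unique σx∈ys)) (ℕ.suc-injective len)))
               (remove-unique ys-unique) pairing-zs
      n = proj₁ rec
      length-zs = proj₁ (proj₂ rec)
      ∏zs = proj₂ (proj₂ rec)

module EulerCriterion (K : FiniteField) (2≢0 : FiniteField.ι K 2 ≢ FiniteField.0# K) where

  open FiniteField K
  open FieldProperties K
  open SquareProperties K
  open UnitProducts K

  -1≢1 : - 1# ≢ 1#
  -1≢1 -1≡1 = 2≢0 (vanishes₁ -1≡1 (solve 0 (:ι 2 := (:- :1) :* ((:- :1) :- :1)) refl))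

  x≢0⇒x≢-x : ∀ {x} → x ≢ 0# → x ≢ - x
  x≢0⇒x≢-x {x} x≢0 x≡-x =
    [ 2≢0 , x≢0 ]′ (x*y≡0⇒x≡0⊎y≡0 (vanishes₁ x≡-x (solve 1 (λ x → :ι 2 :* x := :1 :* (x :- (:- x))) refl x)))

  x²≡y²⇒x≡±y : ∀ {x y} → x * x ≡ y * y → x ≡ y ⊎ x ≡ - y
  x²≡y²⇒x≡±y {x} {y} x²≡y² = Sum.map x-y≡0⇒x≡y x+y≡0⇒x≡-y (x*y≡0⇒x≡0⊎y≡0
    (vanishes₁ x²≡y² (solve 2 (λ x y → (x :- y) :* (x :+ y) := :1 :* (x :* x :- y :* y)) refl x y)))

  units : List F
  units = remove 0# elements

  units-unique : Unique units
  units-unique = remove-unique elements-unique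

  ∈-units : ∀ {x} → x ≢ 0# → x ∈ units
  ∈-units x≢0 = ∈-remove⁺ (elements-complete _) x≢0

  ∈units⇒≢0 : ∀ {x} → x ∈ units → x ≢ 0#
  ∈units⇒≢0 x∈units = proj₂ (∈-remove⁻ {xs = elements} x∈units)

  size≡1+|units| : size ≡ suc (length units)
  size≡1+|units| = length-remove elements-unique (elements-complete 0#)

  module Division (a : F) (a≢0 : a ≢ 0#) where

    σ : F → F
    σ x = a * x ⁻¹

    σ-≢0 : ∀ {x} → x ≢ 0# → σ x ≢ 0#
    σ-≢0 x≢0 = *-≢0 a≢0 (⁻¹-≢0 x≢0)

    σ-product : ∀ {x} → x ≢ 0# → x * σ x ≡ a
    σ-product {x} x≢0 = x-y≡0⇒x≡y (vanishes₁ (inverseʳ x x≢0)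
      (solve 3 (λ a x x⁻¹ → x :* (a :* x⁻¹) :- a := a :* (x :* x⁻¹ :- :1)) refl a x (x ⁻¹)))

    σ-involutive : ∀ {x} → x ≢ 0# → σ (σ x) ≡ x
    σ-involutive {x} x≢0 = begin
      a * (a * x ⁻¹) ⁻¹  ≡⟨ cong (a *_) (sym (⁻¹-unique σx*xa⁻¹≡1)) ⟩
      a * (x * a ⁻¹)     ≡⟨ x-y≡0⇒x≡y (vanishes₁ (inverseʳ a a≢0)
                              (solve 3 (λ a x a⁻¹ → a :* (x :* a⁻¹) :- x := x :* (a :* a⁻¹ :- :1)) refl a x (a ⁻¹))) ⟩
      x                  ∎
      where
      open ≡-Reasoning
      σx*xa⁻¹≡1 : (a * x ⁻¹) * (x * a ⁻¹) ≡ 1#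
      σx*xa⁻¹≡1 = x-y≡0⇒x≡y (vanishes₂ (inverseʳ a a≢0) (inverseʳ x x≢0)
        (solve 4 (λ a x a⁻¹ x⁻¹ → (a :* x⁻¹) :* (x :* a⁻¹) :- :1 := (x :* x⁻¹) :* (a :* a⁻¹ :- :1) :+ :1 :* (x :* x⁻¹ :- :1))
          refl a x (a ⁻¹) (x ⁻¹)))

    x²≡a⇒σ-fixed : ∀ {x} → x ≢ 0# → x * x ≡ a → σ x ≡ x
    x²≡a⇒σ-fixed {x} x≢0 x²≡a = x-y≡0⇒x≡y (vanishes₂ x²≡a (inverseʳ x x≢0)
      (solve 3 (λ a x x⁻¹ → a :* x⁻¹ :- x := (:- x⁻¹) :* (x :* x :- a) :+ x :* (x :* x⁻¹ :- :1)) refl a x (x ⁻¹)))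

    σ-fixed⇒x²≡a : ∀ {x} → x ≢ 0# → σ x ≡ x → x * x ≡ a
    σ-fixed⇒x²≡a {x} x≢0 σx≡x = x-y≡0⇒x≡y (vanishes₂ σx≡x (inverseʳ x x≢0)
      (solve 3 (λ a x x⁻¹ → x :* x :- a := (:- x) :* (a :* x⁻¹ :- x) :+ a :* (x :* x⁻¹ :- :1)) refl a x (x ⁻¹)))

  ∏units-nonsquare : ∀ {a} → a ≢ 0# → ¬ IsSquare a → Σ ℕ λ n → length units ≡ n ℕ.+ n × ∏ units ≡ a ^ n
  ∏units-nonsquare {a} a≢0 ¬□a = ∏-pairing units units-unique (record
    { closed       = λ x∈ → ∈-units (σ-≢0 (∈units⇒≢0 x∈))
    ; involutive   = λ x∈ → σ-involutive (∈units⇒≢0 x∈)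
    ; fixed-free   = λ x∈ σx≡x → ¬□a (_ , σ-fixed⇒x²≡a (∈units⇒≢0 x∈) σx≡x)
    ; pair-product = λ x∈ → σ-product (∈units⇒≢0 x∈)
    })
    where open Division a a≢0

  ∏units-square : ∀ {b} → b ≢ 0# → Σ ℕ λ n → length units ≡ suc n ℕ.+ suc n × ∏ units ≡ - ((b * b) ^ suc n)
  ∏units-square {b} b≢0 = n , length-eq , ∏-eq
    where
    open Division (b * b) (*-≢0 b≢0 b≢0)
    units∖b rest : List F
    units∖b = remove b units
    rest = remove (- b) units∖b
    units∖b-unique : Unique units∖b
    units∖b-unique = remove-unique units-unique
    b∈units : b ∈ units
    b∈units = ∈-units b≢0
    -b∈units∖b : - b ∈ units∖b
    -b∈units∖b = ∈-remove⁺ (∈-units (-‿≢0 b≢0)) (λ -b≡b → x≢0⇒x≢-x b≢0 (sym -b≡b))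
    ∈rest⁺ : ∀ {x} → x ≢ 0# → x ≢ b → x ≢ - b → x ∈ rest
    ∈rest⁺ x≢0 x≢b x≢-b = ∈-remove⁺ (∈-remove⁺ (∈-units x≢0) x≢b) x≢-b
    ∈rest⁻ : ∀ {x} → x ∈ rest → x ≢ 0# × x ≢ b × x ≢ - b
    ∈rest⁻ x∈ with ∈-remove⁻ {xs = units∖b} x∈
    ... | x∈units∖b , x≢-b with ∈-remove⁻ {xs = units} x∈units∖b
    ...   | x∈units , x≢b = ∈units⇒≢0 x∈units , x≢b , x≢-b
    σ-avoids : ∀ {x y} → x ≢ 0# → y ≢ 0# → y * y ≡ b * b → x ≢ y → σ x ≢ y
    σ-avoids x≢0 y≢0 y²≡b² x≢y σx≡y =
      x≢y (trans (sym (σ-involutive x≢0)) (trans (cong σ σx≡y) (x²≡a⇒σ-fixed y≢0 y²≡b²)))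
    -b²≡b² : - b * - b ≡ b * b
    -b²≡b² = solve 1 (λ b → :- b :* :- b := b :* b) refl b
    pairing : IsPairing σ (b * b) rest
    pairing = record
      { closed       = λ x∈ → let (x≢0 , x≢b , x≢-b) = ∈rest⁻ x∈ in
                       ∈rest⁺ (σ-≢0 x≢0) (σ-avoids x≢0 b≢0 refl x≢b) (σ-avoids x≢0 (-‿≢0 b≢0) -b²≡b² x≢-b)
      ; involutive   = λ x∈ → σ-involutive (proj₁ (∈rest⁻ x∈))
      ; fixed-free   = λ x∈ σx≡x → let (x≢0 , x≢b , x≢-b) = ∈rest⁻ x∈ in
                       [ x≢b , x≢-b ]′ (x²≡y²⇒x≡±y (σ-fixed⇒x²≡a x≢0 σx≡x))
      ; pair-product = λ x∈ → σ-product (proj₁ (∈rest⁻ x∈))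
      }
    paired : Σ ℕ λ n → length rest ≡ n ℕ.+ n × ∏ rest ≡ (b * b) ^ n
    paired = ∏-pairing rest (remove-unique units∖b-unique) pairing
    n : ℕ
    n = proj₁ paired
    length-eq : length units ≡ suc n ℕ.+ suc n
    length-eq = begin
      length units                   ≡⟨ length-remove units-unique b∈units ⟩
      suc (length units∖b)           ≡⟨ cong suc (length-remove units∖b-unique -b∈units∖b) ⟩
      suc (suc (length rest))        ≡⟨ cong (λ k → suc (suc k)) (proj₁ (proj₂ paired)) ⟩
      suc (suc (n ℕ.+ n))            ≡⟨ cong suc (ℕ.+-suc n n) ⟨
      suc n ℕ.+ suc n                ∎
      where open ≡-Reasoning
    ∏-eq : ∏ units ≡ - ((b * b) ^ suc n)
    ∏-eq = begin
      ∏ units                        ≡⟨ ∏-remove units-unique b∈units ⟩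
      b * ∏ units∖b                  ≡⟨ cong (b *_) (∏-remove units∖b-unique -b∈units∖b) ⟩
      b * (- b * ∏ rest)             ≡⟨ cong (λ p → b * (- b * p)) (proj₂ (proj₂ paired)) ⟩
      b * (- b * (b * b) ^ n)        ≡⟨ solve 2 (λ b p → b :* (:- b :* p) := :- ((b :* b) :* p)) refl b _ ⟩
      - ((b * b) ^ suc n)            ∎
      where open ≡-Reasoning

  1^n≡1 : ∀ n → 1# ^ n ≡ 1#
  1^n≡1 zero    = refl
  1^n≡1 (suc n) = trans (*-identityˡ _) (1^n≡1 n)

  ^-distrib-* : ∀ x y n → (x * y) ^ n ≡ x ^ n * y ^ n
  ^-distrib-* x y zero    = sym (*-identityˡ 1#)
  ^-distrib-* x y (suc n) = begin
    (x * y) * (x * y) ^ n        ≡⟨ cong ((x * y) *_) (^-distrib-* x y n) ⟩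
    (x * y) * (x ^ n * y ^ n)    ≡⟨ solve 4 (λ x y p q → (x :* y) :* (p :* q) := (x :* p) :* (y :* q)) refl x y (x ^ n) (y ^ n) ⟩
    (x * x ^ n) * (y * y ^ n)    ∎
    where open ≡-Reasoning

  [-1]^[n+n]≡1 : ∀ n → (- 1#) ^ (n ℕ.+ n) ≡ 1#
  [-1]^[n+n]≡1 zero    = refl
  [-1]^[n+n]≡1 (suc n) = begin
    - 1# * (- 1#) ^ (n ℕ.+ suc n)         ≡⟨ cong (λ k → - 1# * (- 1#) ^ k) (ℕ.+-suc n n) ⟩
    - 1# * (- 1# * (- 1#) ^ (n ℕ.+ n))    ≡⟨ cong (λ p → - 1# * (- 1# * p)) ([-1]^[n+n]≡1 n) ⟩
    - 1# * (- 1# * 1#)                    ≡⟨ solve 0 (:- :1 :* (:- :1 :* :1) := :1) refl ⟩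
    1#                                    ∎
    where open ≡-Reasoning

  [-1]^[1+n+n]≡-1 : ∀ n → (- 1#) ^ suc (n ℕ.+ n) ≡ - 1#
  [-1]^[1+n+n]≡-1 n = trans (cong (- 1# *_) ([-1]^[n+n]≡1 n)) (*-identityʳ _)

  +-self-injective : ∀ {m n} → m ℕ.+ m ≡ n ℕ.+ n → m ≡ n
  +-self-injective {m} {n} eq =
    trans (ℕ.n≡⌊n+n/2⌋ m) (trans (cong ℕ.⌊_/2⌋ eq) (sym (ℕ.n≡⌊n+n/2⌋ n)))

  d*4≡[d+d]+[d+d] : ∀ d → d ℕ.* 4 ≡ (d ℕ.+ d) ℕ.+ (d ℕ.+ d)
  d*4≡[d+d]+[d+d] d = begin
    d ℕ.* 4                        ≡⟨ ℕ.*-comm d 4 ⟩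
    d ℕ.+ (d ℕ.+ (d ℕ.+ (d ℕ.+ 0))) ≡⟨ cong (λ k → d ℕ.+ (d ℕ.+ (d ℕ.+ k))) (ℕ.+-identityʳ d) ⟩
    d ℕ.+ (d ℕ.+ (d ℕ.+ d))         ≡⟨ ℕ.+-assoc d d (d ℕ.+ d) ⟨
    (d ℕ.+ d) ℕ.+ (d ℕ.+ d)         ∎
    where open ≡-Reasoning

  euler-criterion : ∀ h {a} → length units ≡ h ℕ.+ h → a ≢ 0# →
                    (IsSquare a → a ^ h ≡ 1#) × (¬ IsSquare a → a ^ h ≡ - 1#)
  euler-criterion h {a} |units|≡h+h a≢0 = square , nonsquare
    where
    half-of-|units| : ∀ n → length units ≡ n ℕ.+ n → n ≡ h
    half-of-|units| n |units|≡n+n = +-self-injective (trans (sym |units|≡n+n) |units|≡h+h)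
    -- Wilson's theorem: the case b = 1 of ∏units-square.
    ∏units≡-1 : ∏ units ≡ - 1#
    ∏units≡-1 =
      let (n , _ , ∏≡) = ∏units-square 1≢0
      in trans ∏≡ (cong -_ (trans (cong (_^ suc n) (*-identityˡ 1#)) (1^n≡1 (suc n))))
    square : IsSquare a → a ^ h ≡ 1#
    square (b , b²≡a) =
      let (n , |units|≡ , ∏≡) = ∏units-square (y²≡x⇒x≢0⇒y≢0 b²≡a a≢0)
      in subst (λ k → a ^ k ≡ 1#) (half-of-|units| (suc n) |units|≡) (-‿injective (begin
        - (a ^ suc n)        ≡⟨ cong (λ x → - (x ^ suc n)) b²≡a ⟨
        - ((b * b) ^ suc n)  ≡⟨ ∏≡ ⟨
        ∏ units              ≡⟨ ∏units≡-1 ⟩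
        - 1#                 ∎))
      where open ≡-Reasoning
    nonsquare : ¬ IsSquare a → a ^ h ≡ - 1#
    nonsquare ¬□a =
      let (n , |units|≡ , ∏≡) = ∏units-nonsquare a≢0 ¬□a
      in subst (λ k → a ^ k ≡ - 1#) (half-of-|units| n |units|≡) (trans (sym ∏≡) ∏units≡-1)

  |units|≡[d+d]+[d+d] : size % 4 ≡ 1 →
    let d = size / 4 in length units ≡ (d ℕ.+ d) ℕ.+ (d ℕ.+ d)
  |units|≡[d+d]+[d+d] q≡1 = ℕ.suc-injective (begin
    suc (length units)             ≡⟨ size≡1+|units| ⟨
    size                           ≡⟨ m≡m%n+[m/n]*n size 4 ⟩
    size % 4 ℕ.+ size / 4 ℕ.* 4    ≡⟨ cong₂ ℕ._+_ q≡1 (d*4≡[d+d]+[d+d] (size / 4)) ⟩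
    suc ((d ℕ.+ d) ℕ.+ (d ℕ.+ d))  ∎)
    where
    open ≡-Reasoning
    d = size / 4

  |units|≡[1+d+d]+[1+d+d] : size % 4 ≡ 3 →
    let d = size / 4 in length units ≡ suc (d ℕ.+ d) ℕ.+ suc (d ℕ.+ d)
  |units|≡[1+d+d]+[1+d+d] q≡3 = ℕ.suc-injective (begin
    suc (length units)                    ≡⟨ size≡1+|units| ⟨
    size                                  ≡⟨ m≡m%n+[m/n]*n size 4 ⟩
    size % 4 ℕ.+ size / 4 ℕ.* 4           ≡⟨ cong₂ ℕ._+_ q≡3 (d*4≡[d+d]+[d+d] (size / 4)) ⟩
    suc (suc (suc ((d ℕ.+ d) ℕ.+ (d ℕ.+ d)))) ≡⟨ cong (λ k → suc (suc k)) (ℕ.+-suc (d ℕ.+ d) (d ℕ.+ d)) ⟨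
    suc (suc (d ℕ.+ d) ℕ.+ suc (d ℕ.+ d))  ∎)
    where
    open ≡-Reasoning
    d = size / 4

  IsSquare[-1]-if-q≡1[4] : size % 4 ≡ 1 → IsSquare (- 1#)
  IsSquare[-1]-if-q≡1[4] q≡1 with IsSquare? (- 1#)
  ... | yes □-1 = □-1
  ... | no ¬□-1 = ⊥-elim (-1≢1 (trans (sym (proj₂ euler ¬□-1)) ([-1]^[n+n]≡1 (size / 4))))
    where euler = euler-criterion (size / 4 ℕ.+ size / 4) (|units|≡[d+d]+[d+d] q≡1) (-‿≢0 1≢0)

  ¬IsSquare[-1]-if-q≡3[4] : size % 4 ≡ 3 → ¬ IsSquare (- 1#)
  ¬IsSquare[-1]-if-q≡3[4] q≡3 □-1 =
    -1≢1 (trans (sym ([-1]^[1+n+n]≡-1 (size / 4))) (proj₁ euler □-1))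
    where euler = euler-criterion (suc (size / 4 ℕ.+ size / 4)) (|units|≡[1+d+d]+[1+d+d] q≡3) (-‿≢0 1≢0)

  IsSquare-or-neg-if-q≡3[4] : size % 4 ≡ 3 → ∀ {x} → x ≢ 0# → IsSquare x ⊎ IsSquare (- x)
  IsSquare-or-neg-if-q≡3[4] q≡3 {x} x≢0 with IsSquare? x | IsSquare? (- x)
  ... | yes □x  | _        = inj₁ □x
  ... | no _    | yes □-x  = inj₂ □-x
  ... | no ¬□x  | no ¬□-x  = ⊥-elim (-1≢1 (begin
    - 1#                          ≡⟨ proj₂ (euler (-‿≢0 x≢0)) ¬□-x ⟨
    (- x) ^ h                     ≡⟨ cong (_^ h) (solve 1 (λ x → :- x := :- :1 :* x) refl x) ⟩
    (- 1# * x) ^ h                ≡⟨ ^-distrib-* (- 1#) x h ⟩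
    (- 1#) ^ h * x ^ h            ≡⟨ cong₂ _*_ ([-1]^[1+n+n]≡-1 (size / 4)) (proj₂ (euler x≢0) ¬□x) ⟩
    - 1# * - 1#                   ≡⟨ solve 0 (:- :1 :* :- :1 := :1) refl ⟩
    1#                            ∎))
    where
    open ≡-Reasoning
    h = suc (size / 4 ℕ.+ size / 4)
    euler : ∀ {a} → a ≢ 0# → (IsSquare a → a ^ h ≡ 1#) × (¬ IsSquare a → a ^ h ≡ - 1#)
    euler = euler-criterion h (|units|≡[1+d+d]+[1+d+d] q≡3)

module LegendreChanges (K : FiniteField) where

  open FiniteField K
  open FieldProperties K

  LegendreRoot : F → F → Set
  LegendreRoot β r = r ≡ 0# ⊎ r ≡ 1# ⊎ r ≡ β

  cubic≡0⇒LegendreRoot : ∀ {β r} → r * (r - 1#) * (r - β) ≡ 0# → LegendreRoot β r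
  cubic≡0⇒LegendreRoot cubic≡0 with x*y≡0⇒x≡0⊎y≡0 cubic≡0
  ... | inj₂ r-β≡0 = inj₂ (inj₂ (x-y≡0⇒x≡y r-β≡0))
  ... | inj₁ r[r-1]≡0 with x*y≡0⇒x≡0⊎y≡0 r[r-1]≡0
  ...   | inj₁ r≡0   = inj₁ r≡0
  ...   | inj₂ r-1≡0 = inj₂ (inj₁ (x-y≡0⇒x≡y r-1≡0))

  LegendreRoot⇒cubic≡0 : ∀ {β r} → LegendreRoot β r → r * (r - 1#) * (r - β) ≡ 0#
  LegendreRoot⇒cubic≡0 {β} {r} (inj₁ r≡0) = begin
    r * (r - 1#) * (r - β)   ≡⟨ cong (λ x → x * (r - 1#) * (r - β)) r≡0 ⟩
    0# * (r - 1#) * (r - β)  ≡⟨ cong (_* (r - β)) (zeroˡ _) ⟩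
    0# * (r - β)             ≡⟨ zeroˡ _ ⟩
    0#                       ∎
    where open ≡-Reasoning
  LegendreRoot⇒cubic≡0 {β} {r} (inj₂ (inj₁ r≡1)) = begin
    r * (r - 1#) * (r - β)   ≡⟨ cong (λ x → r * x * (r - β)) (x≡y⇒x-y≡0 r≡1) ⟩
    r * 0# * (r - β)         ≡⟨ cong (_* (r - β)) (zeroʳ r) ⟩
    0# * (r - β)             ≡⟨ zeroˡ _ ⟩
    0#                       ∎
    where open ≡-Reasoning
  LegendreRoot⇒cubic≡0 {β} {r} (inj₂ (inj₂ r≡β)) = begin
    r * (r - 1#) * (r - β)   ≡⟨ cong (r * (r - 1#) *_) (x≡y⇒x-y≡0 r≡β) ⟩
    r * (r - 1#) * 0#        ≡⟨ zeroʳ _ ⟩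
    0#                       ∎
    where open ≡-Reasoning

  -- With a₁ = a₃ = 0 on both sides, s = t = 0 is forced (away from characteristic 2), and the
  -- remaining change of variables x = u²x′ + r must send the root r of x(x - 1)(x - β) to 0.
  LegendreChange : F → F → Set
  LegendreChange β l = Σ F λ u → Σ F λ r → u ≢ 0#
    × (u * u) * (- (1# + l)) ≡ - (1# + β) + ι 3 * r
    × ((u * u) * (u * u)) * l ≡ β + ι 2 * r * (- (1# + β)) + ι 3 * (r * r)
    × LegendreRoot β r

  :eq₂ :eq₄ : ∀ {n} → Polynomial n → Polynomial n → Polynomial n → Polynomial n → Polynomial n
  :eq₂ u r l β = (u :* u) :* (:- (:1 :+ l)) :- (:- (:1 :+ β) :+ :ι 3 :* r)
  :eq₄ u r l β = ((u :* u) :* (u :* u)) :* l :- (β :+ :ι 2 :* r :* (:- (:1 :+ β)) :+ :ι 3 :* (r :* r))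

  ≅⇒LegendreChange : ∀ {β l} → ι 2 ≢ 0# → Leg β ≅ Leg l → LegendreChange β l
  ≅⇒LegendreChange {β} {l} 2≢0 (u , r , s , t , u≢0 , e₁ , e₂ , e₃ , e₄ , e₆) =
    u , r , u≢0 , eq₂ , eq₄ , cubic≡0⇒LegendreRoot cubic≡0
    where
    s≡0 : s ≡ 0#
    s≡0 = *-cancelˡ-≡0 2≢0 (vanishes₁ e₁
      (solve 2 (λ u s → :ι 2 :* s := (:- :1) :* (u :* :0 :- (:0 :+ :ι 2 :* s))) refl u s))
    t≡0 : t ≡ 0#
    t≡0 = *-cancelˡ-≡0 2≢0 (vanishes₁ e₃
      (solve 3 (λ u r t → :ι 2 :* t := (:- :1) :* ((u :* (u :* (u :* :1))) :* :0 :- (:0 :+ r :* :0 :+ :ι 2 :* t)))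
        refl u r t))
    eq₂ : (u * u) * (- (1# + l)) ≡ - (1# + β) + ι 3 * r
    eq₂ = x-y≡0⇒x≡y (vanishes₂ e₂ s≡0 (solve 5 (λ u r s l β →
      :eq₂ u r l β
      := :1 :* ((u :* (u :* :1)) :* (:- (:1 :+ l)) :- (:- (:1 :+ β) :- s :* :0 :+ :ι 3 :* r :- s :* (s :* :1)))
         :+ (:- s) :* (s :- :0)) refl u r s l β))
    eq₄ : ((u * u) * (u * u)) * l ≡ β + ι 2 * r * (- (1# + β)) + ι 3 * (r * r)
    eq₄ = x-y≡0⇒x≡y (vanishes₃ e₄ s≡0 t≡0 (solve 6 (λ u r s t l β →
      :eq₄ u r l β
      := :1 :* ((u :* (u :* (u :* (u :* :1)))) :* l
                :- (β :- s :* :0 :+ :ι 2 :* r :* (:- (:1 :+ β)) :- (t :+ r :* s) :* :0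
                    :+ :ι 3 :* (r :* (r :* :1)) :- :ι 2 :* s :* t))
         :+ (:- (:ι 2 :* t)) :* (s :- :0) :+ :0 :* (t :- :0)) refl u r s t l β))
    cubic≡0 : r * (r - 1#) * (r - β) ≡ 0#
    cubic≡0 = vanishes₂ e₆ t≡0 (solve 4 (λ u r t β →
      r :* (r :- :1) :* (r :- β)
      := (:- :1) :* ((u :* (u :* (u :* (u :* (u :* (u :* :1)))))) :* :0
                     :- (:0 :+ r :* β :+ (r :* (r :* :1)) :* (:- (:1 :+ β)) :+ r :* (r :* (r :* :1))
                         :- t :* :0 :- t :* (t :* :1) :- r :* t :* :0))
         :+ t :* (t :- :0)) refl u r t β)

  LegendreChange⇒≅ : ∀ {β l} → LegendreChange β l → Leg β ≅ Leg l
  LegendreChange⇒≅ {β} {l} (u , r , u≢0 , eq₂ , eq₄ , root) =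
    u , r , 0# , 0# , u≢0 ,
    solve 1 (λ u → u :* :0 := :0 :+ :ι 2 :* :0) refl u ,
    x-y≡0⇒x≡y (vanishes₁ eq₂ (solve 4 (λ u r l β →
      (u :* (u :* :1)) :* (:- (:1 :+ l)) :- (:- (:1 :+ β) :- :0 :* :0 :+ :ι 3 :* r :- :0 :* (:0 :* :1))
      := :1 :* :eq₂ u r l β) refl u r l β)) ,
    solve 2 (λ u r → (u :* (u :* (u :* :1))) :* :0 := :0 :+ r :* :0 :+ :ι 2 :* :0) refl u r ,
    x-y≡0⇒x≡y (vanishes₁ eq₄ (solve 4 (λ u r l β →
      (u :* (u :* (u :* (u :* :1)))) :* l
        :- (β :- :0 :* :0 :+ :ι 2 :* r :* (:- (:1 :+ β)) :- (:0 :+ r :* :0) :* :0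
            :+ :ι 3 :* (r :* (r :* :1)) :- :ι 2 :* :0 :* :0)
      := :1 :* :eq₄ u r l β)
      refl u r l β)) ,
    x-y≡0⇒x≡y (vanishes₁ (LegendreRoot⇒cubic≡0 root) (solve 3 (λ u r β →
      (u :* (u :* (u :* (u :* (u :* (u :* :1)))))) :* :0
        :- (:0 :+ r :* β :+ (r :* (r :* :1)) :* (:- (:1 :+ β)) :+ r :* (r :* (r :* :1))
            :- :0 :* :0 :- :0 :* (:0 :* :1) :- r :* :0 :* :0)
      := (:- :1) :* (r :* (r :- :1) :* (r :- β) :- :0)) refl u r β))

module Counting (K : FiniteField) where

  open FiniteField K

  record Candidate : Set₁ where
    constructor candidate
    field
      value      : F
      {Condition} : Set
      condition? : Dec Condition

  open Candidate

  IsCandidate : List Candidate → F → Set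
  IsCandidate []       β = ⊥
  IsCandidate (c ∷ cs) β = (β ≡ value c × Condition c) ⊎ IsCandidate cs β

  indicator : ∀ {A : Set} → Dec A → ℕ
  indicator d = if does d then 1 else 0

  count : List Candidate → ℕ
  count []       = 0
  count (c ∷ cs) = indicator (condition? c) ℕ.+ count cs

  HasCard-⇔ : ∀ {P Q : F → Set} {n} → (∀ x → P x ⇔ Q x) → HasCard P n → HasCard Q n
  HasCard-⇔ P⇔Q (xs , unique , length≡n , ∈⇔P) =
    xs , unique , length≡n ,
    λ x → mk⇔ (Equivalence.to (P⇔Q x) ∘′ Equivalence.to (∈⇔P x))
              (Equivalence.from (∈⇔P x) ∘′ Equivalence.from (P⇔Q x))

  IsCandidate⇒∈ : ∀ {cs β} → IsCandidate cs β → β ∈ map value cs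
  IsCandidate⇒∈ {c ∷ cs} (inj₁ (β≡v , _)) = here β≡v
  IsCandidate⇒∈ {c ∷ cs} (inj₂ p)         = there (IsCandidate⇒∈ p)

  HasCard-candidates : ∀ cs → Unique (map value cs) → HasCard (IsCandidate cs) (count cs)
  HasCard-candidates [] _ = [] , [] , refl , λ _ → mk⇔ (λ ()) ⊥-elim
  HasCard-candidates (c ∷ cs) unique-c∷cs@(_ ∷ unique-cs) with HasCard-candidates cs unique-cs | condition? c
  ... | xs , unique , length≡ , ∈⇔ | no ¬cond =
    xs , unique , length≡ ,
    λ β → mk⇔ (inj₂ ∘ Equivalence.to (∈⇔ β)) λ { (inj₁ (_ , cond)) → ⊥-elim (¬cond cond)
                                                 ; (inj₂ p) → Equivalence.from (∈⇔ β) p }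
  ... | xs , unique , length≡ , ∈⇔ | yes cond =
    value c ∷ xs , All.tabulate value≢ ∷ unique , cong suc length≡ ,
    λ β → mk⇔ (λ { (here β≡v) → inj₁ (β≡v , cond) ; (there p) → inj₂ (Equivalence.to (∈⇔ β) p) })
              (λ { (inj₁ (β≡v , _)) → here β≡v ; (inj₂ p) → there (Equivalence.from (∈⇔ β) p) })
    where
    value≢ : ∀ {x} → x ∈ xs → value c ≢ x
    value≢ x∈xs refl = Unique.Unique[x∷xs]⇒x∉xs unique-c∷cs (IsCandidate⇒∈ (Equivalence.to (∈⇔ _) x∈xs))

  indicator-yes : ∀ {A : Set} (d : Dec A) → A → indicator d ≡ 1
  indicator-yes (yes _) _ = refl
  indicator-yes (no ¬a) a = ⊥-elim (¬a a)

  indicator-no : ∀ {A : Set} (d : Dec A) → ¬ A → indicator d ≡ 0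
  indicator-no (yes a) ¬a = ⊥-elim (¬a a)
  indicator-no (no _)  _  = refl

  indicator-cong : ∀ {A B : Set} (dA : Dec A) (dB : Dec B) → (A → B) → (B → A) → indicator dA ≡ indicator dB
  indicator-cong (yes _) (yes _) _   _   = refl
  indicator-cong (no _)  (no _)  _   _   = refl
  indicator-cong (yes a) (no ¬b) A→B _   = ⊥-elim (¬b (A→B a))
  indicator-cong (no ¬a) (yes b) _   B→A = ⊥-elim (¬a (B→A b))

module Classification (K : FiniteField) (2≢0 : FiniteField.ι K 2 ≢ FiniteField.0# K)
                      {l : FiniteField.F K} (λ-admissible : FieldProperties.Admissible K l) where

  open FiniteField K
  open FieldProperties K
  open LegendreChanges K
  open Counting K
  open SquareProperties K

  λ≢0 : l ≢ 0#
  λ≢0 = proj₁ λ-admissible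

  λ≢1 : l ≢ 1#
  λ≢1 = proj₂ λ-admissible

  -- λ/(λ - 1) is written 1 - (1 - λ)⁻¹, so that all six values are obtained from λ by the
  -- involutions x ↦ 1 - x and x ↦ x⁻¹ (see candidate-admissible).
  candidates : List Candidate
  candidates =
    candidate l                  (yes tt) ∷
    candidate (1# - l)           (IsSquare? (- 1#)) ∷
    candidate (l ⁻¹)             (IsSquare? l) ∷
    candidate (1# - l ⁻¹)        (IsSquare? (- l)) ∷
    candidate (1# - (1# - l) ⁻¹) (IsSquare? (1# - l)) ∷
    candidate ((1# - l) ⁻¹)      (IsSquare? (- (1# - l))) ∷ []

  module _ {β : F} where

    is-λ : β ≡ l → IsCandidate candidates β
    is-λ β≡ = inj₁ (β≡ , tt)

    is-1-λ : β ≡ 1# - l → IsSquare (- 1#) → IsCandidate candidates β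
    is-1-λ β≡ □ = inj₂ (inj₁ (β≡ , □))

    is-λ⁻¹ : β ≡ l ⁻¹ → IsSquare l → IsCandidate candidates β
    is-λ⁻¹ β≡ □ = inj₂ (inj₂ (inj₁ (β≡ , □)))

    is-1-λ⁻¹ : β ≡ 1# - l ⁻¹ → IsSquare (- l) → IsCandidate candidates β
    is-1-λ⁻¹ β≡ □ = inj₂ (inj₂ (inj₂ (inj₁ (β≡ , □))))

    is-1-[1-λ]⁻¹ : β ≡ 1# - (1# - l) ⁻¹ → IsSquare (1# - l) → IsCandidate candidates β
    is-1-[1-λ]⁻¹ β≡ □ = inj₂ (inj₂ (inj₂ (inj₂ (inj₁ (β≡ , □)))))

    is-[1-λ]⁻¹ : β ≡ (1# - l) ⁻¹ → IsSquare (- (1# - l)) → IsCandidate candidates β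
    is-[1-λ]⁻¹ β≡ □ = inj₂ (inj₂ (inj₂ (inj₂ (inj₂ (inj₁ (β≡ , □))))))

  1-λ≢0 : 1# - l ≢ 0#
  1-λ≢0 = proj₁ (1-‿admissible λ-admissible)

  -[λ/[1-λ]]≡1-[1-λ]⁻¹ : - (l * (1# - l) ⁻¹) ≡ 1# - (1# - l) ⁻¹
  -[λ/[1-λ]]≡1-[1-λ]⁻¹ = x-y≡0⇒x≡y (vanishes₁ (inverseʳ (1# - l) 1-λ≢0)
    (solve 2 (λ l c → :- (l :* c) :- (:1 :- c) := :1 :* ((:1 :- l) :* c :- :1)) refl l ((1# - l) ⁻¹)))

  -- In each of the three cases the two coefficient equations make a product of two factors
  -- vanish; each factor determines β and exhibits the square condition of its candidate.
  classify-r≡0 : ∀ {β} u → (u * u) * (- (1# + l)) ≡ - (1# + β) + ι 3 * 0# →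
                 ((u * u) * (u * u)) * l ≡ β + ι 2 * 0# * (- (1# + β)) + ι 3 * (0# * 0#) →
                 IsCandidate candidates β
  classify-r≡0 {β} u eq₂ eq₄ = [ U≡1 , Uλ≡1 ]′ (x*y≡0⇒x≡0⊎y≡0 (vanishes₂ eq₂ eq₄ (solve 3 (λ u l β →
      (u :* u :- :1) :* (:1 :- u :* u :* l)
      := (:- :1) :* :eq₂ u :0 l β
         :+ (:- :1) :* :eq₄ u :0 l β)
    refl u l β)))
    where
    U≡1 : u * u - 1# ≡ 0# → IsCandidate candidates β
    U≡1 U-1≡0 = is-λ (x-y≡0⇒x≡y (vanishes₂ eq₄ U-1≡0 (solve 3 (λ u l β →
      β :- l := (:- :1) :* :eq₄ u :0 l β
                :+ (l :+ l :* u :* u) :* ((u :* u :- :1) :- :0)) refl u l β)))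
    Uλ≡1 : 1# - u * u * l ≡ 0# → IsCandidate candidates β
    Uλ≡1 1-Uλ≡0 = is-λ⁻¹ (trans β≡U (⁻¹-unique (trans (*-comm l (u * u)) (sym 1≡Uλ)))) (IsSquare-⁻¹ (sym 1≡Uλ))
      where
      1≡Uλ : 1# ≡ u * u * l
      1≡Uλ = x-y≡0⇒x≡y 1-Uλ≡0
      β≡U : β ≡ u * u
      β≡U = x-y≡0⇒x≡y (vanishes₂ eq₄ 1-Uλ≡0 (solve 3 (λ u l β →
        β :- u :* u := (:- :1) :* :eq₄ u :0 l β
                        :+ (:- (u :* u)) :* ((:1 :- u :* u :* l) :- :0)) refl u l β))

  classify-r≡1 : ∀ {β} u → (u * u) * (- (1# + l)) ≡ - (1# + β) + ι 3 * 1# →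
                 ((u * u) * (u * u)) * l ≡ β + ι 2 * 1# * (- (1# + β)) + ι 3 * (1# * 1#) →
                 IsCandidate candidates β
  classify-r≡1 {β} u eq₂ eq₄ = [ λU≡-1 , U≡-1 ]′ (x*y≡0⇒x≡0⊎y≡0 (vanishes₂ eq₂ eq₄ (solve 3 (λ u l β →
      (l :* (u :* u) :+ :1) :* (u :* u :+ :1)
      := (:- :1) :* :eq₂ u :1 l β
         :+ :1 :* :eq₄ u :1 l β)
    refl u l β)))
    where
    λU≡-1 : l * (u * u) + 1# ≡ 0# → IsCandidate candidates β
    λU≡-1 λU+1≡0 = is-1-λ⁻¹ (trans β≡1-[-U] (cong (λ x → 1# - x) -U≡λ⁻¹)) (IsSquare-⁻¹ U[-λ]≡1)
      where
      β≡1-[-U] : β ≡ 1# - (- (u * u))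
      β≡1-[-U] = x-y≡0⇒x≡y (vanishes₂ eq₄ λU+1≡0 (solve 3 (λ u l β →
        β :- (:1 :- (:- (u :* u)))
        := :1 :* :eq₄ u :1 l β
           :+ (:- (u :* u)) :* ((l :* (u :* u) :+ :1) :- :0)) refl u l β))
      -U≡λ⁻¹ : - (u * u) ≡ l ⁻¹
      -U≡λ⁻¹ = ⁻¹-unique (x-y≡0⇒x≡y (vanishes₁ λU+1≡0 (solve 2 (λ u l →
        l :* (:- (u :* u)) :- :1 := (:- :1) :* ((l :* (u :* u) :+ :1) :- :0)) refl u l)))
      U[-λ]≡1 : (u * u) * (- l) ≡ 1#
      U[-λ]≡1 = x-y≡0⇒x≡y (vanishes₁ λU+1≡0 (solve 2 (λ u l →
        (u :* u) :* (:- l) :- :1 := (:- :1) :* ((l :* (u :* u) :+ :1) :- :0)) refl u l))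
    U≡-1 : u * u + 1# ≡ 0# → IsCandidate candidates β
    U≡-1 U+1≡0 = is-1-λ β≡1-λ (u , x-y≡0⇒x≡y (vanishes₁ U+1≡0
      (solve 1 (λ u → u :* u :- (:- :1) := :1 :* ((u :* u :+ :1) :- :0)) refl u)))
      where
      β≡1-λ : β ≡ 1# - l
      β≡1-λ = x-y≡0⇒x≡y (vanishes₂ eq₄ U+1≡0 (solve 3 (λ u l β →
        β :- (:1 :- l)
        := :1 :* :eq₄ u :1 l β
           :+ (l :- l :* u :* u) :* ((u :* u :+ :1) :- :0)) refl u l β))

  classify-r≡β : ∀ {β} u → (u * u) * (- (1# + l)) ≡ - (1# + β) + ι 3 * β →
                 ((u * u) * (u * u)) * l ≡ β + ι 2 * β * (- (1# + β)) + ι 3 * (β * β) →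
                 IsCandidate candidates β
  classify-r≡β {β} u eq₂ eq₄ = [ U[1-λ]≡1 , U[1-λ]≡-1 ]′ (x*y≡0⇒x≡0⊎y≡0 (vanishes₂ eq₂ eq₄ (solve 3 (λ u l β →
      (u :* u :* (:1 :- l) :- :1) :* (u :* u :* (:1 :- l) :+ :1)
      := ((:- :1) :- l :* u :* u :- u :* u :+ :ι 2 :* β) :* :eq₂ u β l β
         :+ (:- :ι 4) :* :eq₄ u β l β)
    refl u l β)))
    where
    U[1-λ]≡1 : u * u * (1# - l) - 1# ≡ 0# → IsCandidate candidates β
    U[1-λ]≡1 U[1-λ]-1≡0 =
      is-1-[1-λ]⁻¹ (trans β≡-λU (trans (cong (λ x → - (l * x)) U≡[1-λ]⁻¹) -[λ/[1-λ]]≡1-[1-λ]⁻¹))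
                   (IsSquare-⁻¹ (x-y≡0⇒x≡y (vanishes₁ U[1-λ]-1≡0 (solve 2 (λ u l →
                      (u :* u) :* (:1 :- l) :- :1 := :1 :* ((u :* u :* (:1 :- l) :- :1) :- :0)) refl u l))))
      where
      β≡-λU : β ≡ - (l * (u * u))
      β≡-λU = x+y≡0⇒x≡-y (*-cancelˡ-≡0 2≢0 (vanishes₂ eq₂ U[1-λ]-1≡0 (solve 3 (λ u l β →
        :ι 2 :* (β :+ l :* (u :* u))
        := (:- :1) :* :eq₂ u β l β
           :+ (:- :1) :* ((u :* u :* (:1 :- l) :- :1) :- :0)) refl u l β)))
      U≡[1-λ]⁻¹ : u * u ≡ (1# - l) ⁻¹
      U≡[1-λ]⁻¹ = ⁻¹-unique (x-y≡0⇒x≡y (vanishes₁ U[1-λ]-1≡0 (solve 2 (λ u l →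
        (:1 :- l) :* (u :* u) :- :1 := :1 :* ((u :* u :* (:1 :- l) :- :1) :- :0)) refl u l)))
    U[1-λ]≡-1 : u * u * (1# - l) + 1# ≡ 0# → IsCandidate candidates β
    U[1-λ]≡-1 U[1-λ]+1≡0 =
      is-[1-λ]⁻¹ (trans β≡-U -U≡[1-λ]⁻¹)
                 (IsSquare-⁻¹ (x-y≡0⇒x≡y (vanishes₁ U[1-λ]+1≡0 (solve 2 (λ u l →
                    (u :* u) :* (:- (:1 :- l)) :- :1 := (:- :1) :* ((u :* u :* (:1 :- l) :+ :1) :- :0)) refl u l))))
      where
      β≡-U : β ≡ - (u * u)
      β≡-U = x+y≡0⇒x≡-y (*-cancelˡ-≡0 2≢0 (vanishes₂ eq₂ U[1-λ]+1≡0 (solve 3 (λ u l β →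
        :ι 2 :* (β :+ u :* u)
        := (:- :1) :* :eq₂ u β l β
           :+ :1 :* ((u :* u :* (:1 :- l) :+ :1) :- :0)) refl u l β)))
      -U≡[1-λ]⁻¹ : - (u * u) ≡ (1# - l) ⁻¹
      -U≡[1-λ]⁻¹ = ⁻¹-unique (x-y≡0⇒x≡y (vanishes₁ U[1-λ]+1≡0 (solve 2 (λ u l →
        (:1 :- l) :* (:- (u :* u)) :- :1 := (:- :1) :* ((u :* u :* (:1 :- l) :+ :1) :- :0)) refl u l)))

  classify : ∀ {β} → LegendreChange β l → IsCandidate candidates β
  classify (u , _ , _ , eq₂ , eq₄ , inj₁ refl)         = classify-r≡0 u eq₂ eq₄
  classify (u , _ , _ , eq₂ , eq₄ , inj₂ (inj₁ refl))  = classify-r≡1 u eq₂ eq₄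
  classify (u , _ , _ , eq₂ , eq₄ , inj₂ (inj₂ refl))  = classify-r≡β u eq₂ eq₄

  change-λ : LegendreChange l l
  change-λ = 1# , 0# , 1≢0 ,
    solve 1 (λ l → (:1 :* :1) :* (:- (:1 :+ l)) := :- (:1 :+ l) :+ :ι 3 :* :0) refl l ,
    solve 1 (λ l → ((:1 :* :1) :* (:1 :* :1)) :* l := l :+ :ι 2 :* :0 :* (:- (:1 :+ l)) :+ :ι 3 :* (:0 :* :0)) refl l ,
    inj₁ refl

  change-1-λ : IsSquare (- 1#) → LegendreChange (1# - l) l
  change-1-λ (i , i²≡-1) = i , 1# , y²≡x⇒x≢0⇒y≢0 i²≡-1 (-‿≢0 1≢0) ,
    x-y≡0⇒x≡y (vanishes₁ i²≡-1 (solve 2 (λ u l →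
      :eq₂ u :1 l (:1 :- l)
      := ((:- :1) :- l) :* (u :* u :- (:- :1))) refl i l)) ,
    x-y≡0⇒x≡y (vanishes₁ i²≡-1 (solve 2 (λ u l →
      :eq₄ u :1 l (:1 :- l)
      := ((:- l) :+ l :* u :* u) :* (u :* u :- (:- :1))) refl i l)) ,
    inj₂ (inj₁ refl)

  change-λ⁻¹ : IsSquare l → LegendreChange (l ⁻¹) l
  change-λ⁻¹ (y , y²≡λ) = y ⁻¹ , 0# , ⁻¹-≢0 (y²≡x⇒x≢0⇒y≢0 y²≡λ λ≢0) ,
    x-y≡0⇒x≡y (vanishes₂ Uλ≡1 λλ⁻¹≡1 (solve 3 (λ u l b →
      :eq₂ u :0 l b
      := ((:- :1) :- b) :* ((u :* u) :* l :- :1) :+ (u :* u) :* (l :* b :- :1)) refl (y ⁻¹) l (l ⁻¹))) ,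
    x-y≡0⇒x≡y (vanishes₂ Uλ≡1 λλ⁻¹≡1 (solve 3 (λ u l b →
      :eq₄ u :0 l b
      := (b :+ u :* u) :* ((u :* u) :* l :- :1) :+ (:- (u :* u)) :* (l :* b :- :1)) refl (y ⁻¹) l (l ⁻¹))) ,
    inj₁ refl
    where
    Uλ≡1 : (y ⁻¹ * y ⁻¹) * l ≡ 1#
    Uλ≡1 = y²≡x⇒[y⁻¹]²x≡1 y²≡λ λ≢0
    λλ⁻¹≡1 : l * l ⁻¹ ≡ 1#
    λλ⁻¹≡1 = inverseʳ l λ≢0

  change-1-λ⁻¹ : IsSquare (- l) → LegendreChange (1# - l ⁻¹) l
  change-1-λ⁻¹ (y , y²≡-λ) = y ⁻¹ , 1# , ⁻¹-≢0 (y²≡x⇒x≢0⇒y≢0 y²≡-λ (-‿≢0 λ≢0)) ,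
    x-y≡0⇒x≡y (vanishes₂ U[-λ]≡1 λλ⁻¹≡1 (solve 3 (λ u l a →
      :eq₂ u :1 l (:1 :- a)
      := (:1 :+ a) :* ((u :* u) :* (:- l) :- :1) :+ (u :* u) :* (l :* a :- :1)) refl (y ⁻¹) l (l ⁻¹))) ,
    x-y≡0⇒x≡y (vanishes₂ U[-λ]≡1 λλ⁻¹≡1 (solve 3 (λ u l a →
      :eq₄ u :1 l (:1 :- a)
      := (a :- u :* u) :* ((u :* u) :* (:- l) :- :1) :+ (u :* u) :* (l :* a :- :1)) refl (y ⁻¹) l (l ⁻¹))) ,
    inj₂ (inj₁ refl)
    where
    U[-λ]≡1 : (y ⁻¹ * y ⁻¹) * (- l) ≡ 1#
    U[-λ]≡1 = y²≡x⇒[y⁻¹]²x≡1 y²≡-λ (-‿≢0 λ≢0)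
    λλ⁻¹≡1 : l * l ⁻¹ ≡ 1#
    λλ⁻¹≡1 = inverseʳ l λ≢0

  change-1-[1-λ]⁻¹ : IsSquare (1# - l) → LegendreChange (1# - (1# - l) ⁻¹) l
  change-1-[1-λ]⁻¹ (y , y²≡1-λ) = subst (λ b → LegendreChange b l) -[λ/[1-λ]]≡1-[1-λ]⁻¹
    (y ⁻¹ , - (l * c) , ⁻¹-≢0 (y²≡x⇒x≢0⇒y≢0 y²≡1-λ 1-λ≢0) ,
     x-y≡0⇒x≡y (vanishes₂ U[1-λ]≡1 [1-λ]c≡1 (solve 3 (λ u l c →
       :eq₂ u (:- (l :* c)) l (:- (l :* c))
       := (:1 :- :ι 2 :* c) :* ((u :* u) :* (:1 :- l) :- :1)
          :+ ((:- :ι 2) :+ :ι 2 :* u :* u) :* ((:1 :- l) :* c :- :1)) refl (y ⁻¹) l c)) ,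
     x-y≡0⇒x≡y (vanishes₂ U[1-λ]≡1 [1-λ]c≡1 (solve 3 (λ u l c →
       :eq₄ u (:- (l :* c)) l (:- (l :* c))
       := ((:- c) :+ c :* c :+ c :* u :* u :- u :* u) :* ((u :* u) :* (:1 :- l) :- :1)
          :+ (c :+ c :* l :- c :* u :* u :+ u :* u :- u :* u :* u :* u) :* ((:1 :- l) :* c :- :1)) refl (y ⁻¹) l c)) ,
     inj₂ (inj₂ refl))
    where
    c : F
    c = (1# - l) ⁻¹
    U[1-λ]≡1 : (y ⁻¹ * y ⁻¹) * (1# - l) ≡ 1#
    U[1-λ]≡1 = y²≡x⇒[y⁻¹]²x≡1 y²≡1-λ 1-λ≢0
    [1-λ]c≡1 : (1# - l) * c ≡ 1#
    [1-λ]c≡1 = inverseʳ (1# - l) 1-λ≢0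

  change-[1-λ]⁻¹ : IsSquare (- (1# - l)) → LegendreChange ((1# - l) ⁻¹) l
  change-[1-λ]⁻¹ (y , y²≡λ-1) = y ⁻¹ , c , ⁻¹-≢0 (y²≡x⇒x≢0⇒y≢0 y²≡λ-1 (-‿≢0 1-λ≢0)) ,
    x-y≡0⇒x≡y (vanishes₂ U[λ-1]≡1 [1-λ]c≡1 (solve 3 (λ u l c →
      :eq₂ u c l c
      := ((:- :1) :+ :ι 2 :* c) :* ((u :* u) :* (:- (:1 :- l)) :- :1)
         :+ (:ι 2 :* u :* u) :* ((:1 :- l) :* c :- :1)) refl (y ⁻¹) l c)) ,
    x-y≡0⇒x≡y (vanishes₂ U[λ-1]≡1 [1-λ]c≡1 (solve 3 (λ u l c →
      :eq₄ u c l c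
      := ((:- c) :+ c :* c :- c :* u :* u :+ u :* u) :* ((u :* u) :* (:- (:1 :- l)) :- :1)
         :+ (c :* u :* u :- u :* u :- u :* u :* u :* u) :* ((:1 :- l) :* c :- :1)) refl (y ⁻¹) l c)) ,
    inj₂ (inj₂ refl)
    where
    c : F
    c = (1# - l) ⁻¹
    U[λ-1]≡1 : (y ⁻¹ * y ⁻¹) * (- (1# - l)) ≡ 1#
    U[λ-1]≡1 = y²≡x⇒[y⁻¹]²x≡1 y²≡λ-1 (-‿≢0 1-λ≢0)
    [1-λ]c≡1 : (1# - l) * c ≡ 1#
    [1-λ]c≡1 = inverseʳ (1# - l) 1-λ≢0

  realise : ∀ {β} → IsCandidate candidates β → LegendreChange β l
  realise (inj₁ (refl , _))                                     = change-λ
  realise (inj₂ (inj₁ (refl , □)))                              = change-1-λ □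
  realise (inj₂ (inj₂ (inj₁ (refl , □))))                       = change-λ⁻¹ □
  realise (inj₂ (inj₂ (inj₂ (inj₁ (refl , □)))))                = change-1-λ⁻¹ □
  realise (inj₂ (inj₂ (inj₂ (inj₂ (inj₁ (refl , □))))))         = change-1-[1-λ]⁻¹ □
  realise (inj₂ (inj₂ (inj₂ (inj₂ (inj₂ (inj₁ (refl , □)))))))  = change-[1-λ]⁻¹ □

  candidate-admissible : ∀ {β} → IsCandidate candidates β → Admissible β
  candidate-admissible (inj₁ (refl , _))                                     = λ-admissible
  candidate-admissible (inj₂ (inj₁ (refl , _)))                              = 1-‿admissible λ-admissible
  candidate-admissible (inj₂ (inj₂ (inj₁ (refl , _))))                       = ⁻¹-admissible λ-admissible
  candidate-admissible (inj₂ (inj₂ (inj₂ (inj₁ (refl , _)))))                = 1-‿admissible (⁻¹-admissible λ-admissible)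
  candidate-admissible (inj₂ (inj₂ (inj₂ (inj₂ (inj₁ (refl , _))))))         = 1-‿admissible (⁻¹-admissible (1-‿admissible λ-admissible))
  candidate-admissible (inj₂ (inj₂ (inj₂ (inj₂ (inj₂ (inj₁ (refl , _)))))))  = ⁻¹-admissible (1-‿admissible λ-admissible)

  L⇔IsCandidate : ∀ β → L l β ⇔ IsCandidate candidates β
  L⇔IsCandidate β = mk⇔
    (λ (_ , _ , β≅λ) → classify (≅⇒LegendreChange 2≢0 β≅λ))
    (λ β∈ → let (β≢0 , β≢1) = candidate-admissible β∈ in β≢0 , β≢1 , LegendreChange⇒≅ (realise β∈))

module JInvariant (K : FiniteField) (l : FiniteField.F K) where

  open FiniteField K
  open FieldProperties K

  ^-≢0 : ∀ {x} n → x ≢ 0# → x ^ n ≢ 0#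
  ^-≢0 zero    _   = 1≢0
  ^-≢0 (suc n) x≢0 = *-≢0 x≢0 (^-≢0 n x≢0)

  Δ : F
  Δ = (l ^ 2) * ((l - 1#) ^ 2)

  Δ≢0 : Admissible l → Δ ≢ 0#
  Δ≢0 (λ≢0 , λ≢1) = *-≢0 (^-≢0 2 λ≢0) (^-≢0 2 (λ l-1≡0 → λ≢1 (x-y≡0⇒x≡y l-1≡0)))

  :jLeg : ∀ {n} → Polynomial n → Polynomial n → Polynomial n
  :jLeg l Δ⁻¹ = :ι 256 :* (g :* (g :* (g :* :1))) :* Δ⁻¹
    where g = l :* (l :* :1) :- l :+ :1

  :Δ : ∀ {n} → Polynomial n → Polynomial n
  :Δ l = (l :* (l :* :1)) :* ((l :- :1) :* ((l :- :1) :* :1))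

  j≢0⇒2≢0 : jLeg l ≢ 0# → ι 2 ≢ 0#
  j≢0⇒2≢0 j≢0 2≡0 = j≢0 (x-y≡0⇒x≡y (vanishes₁ 2≡0 (solve 2 (λ l b →
    :jLeg l b :- :0
    := (:κ 128 :* b :- :κ 384 :* b :* l :+ :κ 768 :* b :* l :* l :- :κ 896 :* b :* l :* l :* l
        :+ :κ 768 :* b :* l :* l :* l :* l :- :κ 384 :* b :* l :* l :* l :* l :* l
        :+ :κ 128 :* b :* l :* l :* l :* l :* l :* l)
       :* (:ι 2 :- :0)) refl l (Δ ⁻¹))))

  j≢0⇒λ²-λ+1≢0 : jLeg l ≢ 0# → l * l - l + 1# ≢ 0#
  j≢0⇒λ²-λ+1≢0 j≢0 G≡0 = j≢0 (x-y≡0⇒x≡y (vanishes₁ G≡0 (solve 2 (λ l b →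
    :jLeg l b :- :0
    := (:κ 256 :* b :- :κ 512 :* b :* l :+ :κ 768 :* b :* l :* l :- :κ 512 :* b :* l :* l :* l
        :+ :κ 256 :* b :* l :* l :* l :* l)
       :* ((l :* l :- l :+ :1) :- :0)) refl l (Δ ⁻¹))))

  j≢1728⇒[λ+1][λ-2][2λ-1]≢0 : Admissible l → jLeg l ≢ ι 1728 →
                               (l + 1#) * ((l - ι 2) * (ι 2 * l - 1#)) ≢ 0#
  j≢1728⇒[λ+1][λ-2][2λ-1]≢0 λ-admissible j≢1728 H≡0 =
    [ j≢1728 ∘ x-y≡0⇒x≡y , Δ≢0 λ-admissible ]′ (x*y≡0⇒x≡0⊎y≡0
      (vanishes₂ (inverseˡ Δ (Δ≢0 λ-admissible)) H≡0 (solve 2 (λ l b →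
        (:jLeg l b :- :ι 1728) :* :Δ l
        := (:κ 256 :- :κ 768 :* l :+ :κ 1536 :* l :* l :- :κ 1792 :* l :* l :* l :+ :κ 1536 :* l :* l :* l :* l
            :- :κ 768 :* l :* l :* l :* l :* l :+ :κ 256 :* l :* l :* l :* l :* l :* l)
           :* (b :* :Δ l :- :1)
           :+ (:κ 128 :- :κ 192 :* l :- :κ 192 :* l :* l :+ :κ 128 :* l :* l :* l)
           :* ((l :+ :1) :* ((l :- :ι 2) :* (:ι 2 :* l :- :1)) :- :0)) refl l (Δ ⁻¹))))

module CandidatesDistinct (K : FiniteField) {l : FiniteField.F K}
                          (λ-admissible : FieldProperties.Admissible K l)
                          (j≢0 : FiniteField.jLeg K l ≢ FiniteField.0# K)
                          (j≢1728 : FiniteField.jLeg K l ≢ FiniteField.ι K 1728) where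

  open FiniteField K
  open FieldProperties K
  open JInvariant K l
  open Counting K using (module Candidate)
  open Candidate using (value)
  open Classification K (j≢0⇒2≢0 j≢0) λ-admissible

  λ²-λ+1≢0 : l * l - l + 1# ≢ 0#
  λ²-λ+1≢0 = j≢0⇒λ²-λ+1≢0 j≢0

  [λ+1][λ-2][2λ-1]≢0 : (l + 1#) * ((l - ι 2) * (ι 2 * l - 1#)) ≢ 0#
  [λ+1][λ-2][2λ-1]≢0 = j≢1728⇒[λ+1][λ-2][2λ-1]≢0 λ-admissible j≢1728

  -- λ⁻¹ and (1 - λ)⁻¹ enter only through their defining equations, so every coincidence between
  -- two candidates forces one of the two polynomials excluded by j ∉ {0, 1728} to vanish.
  separated : ∀ {x y P k₁ k₂ k₃} → P ≢ 0# →
              P ≡ k₁ * (x - y) + k₂ * (l * l ⁻¹ - 1#) + k₃ * ((1# - l) * (1# - l) ⁻¹ - 1#) → x ≢ y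
  separated P≢0 cert x≡y =
    P≢0 (vanishes₃ x≡y (inverseʳ l (proj₁ λ-admissible)) (inverseʳ (1# - l) 1-λ≢0) cert)

  candidates-distinct : Unique (map value candidates)
  candidates-distinct =
    (λ≢1-λ ∷ λ≢λ⁻¹ ∷ λ≢1-λ⁻¹ ∷ λ≢1-[1-λ]⁻¹ ∷ λ≢[1-λ]⁻¹ ∷ []) ∷
    (1-λ≢λ⁻¹ ∷ 1-λ≢1-λ⁻¹ ∷ 1-λ≢1-[1-λ]⁻¹ ∷ 1-λ≢[1-λ]⁻¹ ∷ []) ∷
    (λ⁻¹≢1-λ⁻¹ ∷ λ⁻¹≢1-[1-λ]⁻¹ ∷ λ⁻¹≢[1-λ]⁻¹ ∷ []) ∷
    (1-λ⁻¹≢1-[1-λ]⁻¹ ∷ 1-λ⁻¹≢[1-λ]⁻¹ ∷ []) ∷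
    (1-[1-λ]⁻¹≢[1-λ]⁻¹ ∷ []) ∷
    [] ∷ []
    where
    λ≢1-λ : l ≢ 1# - l
    λ≢1-λ = separated [λ+1][λ-2][2λ-1]≢0 (solve 3 (λ l a c →
      (l :+ :1) :* ((l :- :ι 2) :* (:ι 2 :* l :- :1))
      := ((:- :ι 2) :- l :+ (l :* l)) :* (l :- (:1 :- l))
         :+ :0 :* ((l :* a) :- :1)
         :+ :0 :* (((:1 :- l) :* c) :- :1)) refl l (l ⁻¹) ((1# - l) ⁻¹))

    λ≢λ⁻¹ : l ≢ l ⁻¹
    λ≢λ⁻¹ = separated [λ+1][λ-2][2λ-1]≢0 (solve 3 (λ l a c →
      (l :+ :1) :* ((l :- :ι 2) :* (:ι 2 :* l :- :1))
      := ((:- :ι 3) :+ (:ι 2 :* a :* l) :+ c :- (:ι 3 :* l) :+ (:ι 2 :* l :* l)) :* (l :- a)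
         :+ ((:- :ι 3) :+ (:ι 2 :* a) :+ c) :* ((l :* a) :- :1)
         :+ (:1 :+ a) :* (((:1 :- l) :* c) :- :1)) refl l (l ⁻¹) ((1# - l) ⁻¹))

    λ≢1-λ⁻¹ : l ≢ 1# - l ⁻¹
    λ≢1-λ⁻¹ = separated λ²-λ+1≢0 (solve 3 (λ l a c →
      l :* l :- l :+ :1
      := l :* (l :- (:1 :- a))
         :+ (:- :1) :* ((l :* a) :- :1)
         :+ :0 :* (((:1 :- l) :* c) :- :1)) refl l (l ⁻¹) ((1# - l) ⁻¹))

    λ≢1-[1-λ]⁻¹ : l ≢ 1# - (1# - l) ⁻¹
    λ≢1-[1-λ]⁻¹ = subst (l ≢_) -[λ/[1-λ]]≡1-[1-λ]⁻¹ (separated [λ+1][λ-2][2λ-1]≢0 (solve 3 (λ l a c →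
      (l :+ :1) :* ((l :- :ι 2) :* (:ι 2 :* l :- :1))
      := ((:- :ι 2) :+ a :- l :+ (:ι 2 :* l :* l)) :* (l :- (:- (l :* c)))
         :+ ((:- :1) :- c) :* ((l :* a) :- :1)
         :+ ((:- :1) :+ l :+ (:ι 2 :* l :* l)) :* (((:1 :- l) :* c) :- :1)) refl l (l ⁻¹) ((1# - l) ⁻¹)))

    λ≢[1-λ]⁻¹ : l ≢ (1# - l) ⁻¹
    λ≢[1-λ]⁻¹ = separated λ²-λ+1≢0 (solve 3 (λ l a c →
      l :* l :- l :+ :1
      := ((:- :1) :+ l) :* (l :- c)
         :+ :0 :* ((l :* a) :- :1)
         :+ (:- :1) :* (((:1 :- l) :* c) :- :1)) refl l (l ⁻¹) ((1# - l) ⁻¹))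

    1-λ≢λ⁻¹ : 1# - l ≢ l ⁻¹
    1-λ≢λ⁻¹ = ≢-sym (separated λ²-λ+1≢0 (solve 3 (λ l a c →
      l :* l :- l :+ :1
      := l :* (a :- (:1 :- l))
         :+ (:- :1) :* ((l :* a) :- :1)
         :+ :0 :* (((:1 :- l) :* c) :- :1)) refl l (l ⁻¹) ((1# - l) ⁻¹)))

    1-λ≢1-λ⁻¹ : 1# - l ≢ 1# - l ⁻¹
    1-λ≢1-λ⁻¹ = separated [λ+1][λ-2][2λ-1]≢0 (solve 3 (λ l a c →
      (l :+ :1) :* ((l :- :ι 2) :* (:ι 2 :* l :- :1))
      := (:ι 3 :- (:ι 2 :* a :* l) :- c :+ (:ι 3 :* l) :- (:ι 2 :* l :* l)) :* ((:1 :- l) :- (:1 :- a))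
         :+ ((:- :ι 3) :+ (:ι 2 :* a) :+ c) :* ((l :* a) :- :1)
         :+ (:1 :+ a) :* (((:1 :- l) :* c) :- :1)) refl l (l ⁻¹) ((1# - l) ⁻¹))

    1-λ≢1-[1-λ]⁻¹ : 1# - l ≢ 1# - (1# - l) ⁻¹
    1-λ≢1-[1-λ]⁻¹ = subst (1# - l ≢_) -[λ/[1-λ]]≡1-[1-λ]⁻¹ (separated λ²-λ+1≢0 (solve 3 (λ l a c →
      l :* l :- l :+ :1
      := (:1 :- l) :* ((:1 :- l) :- (:- (l :* c)))
         :+ :0 :* ((l :* a) :- :1)
         :+ (:- l) :* (((:1 :- l) :* c) :- :1)) refl l (l ⁻¹) ((1# - l) ⁻¹)))

    1-λ≢[1-λ]⁻¹ : 1# - l ≢ (1# - l) ⁻¹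
    1-λ≢[1-λ]⁻¹ = separated [λ+1][λ-2][2λ-1]≢0 (solve 3 (λ l a c →
      (l :+ :1) :* ((l :- :ι 2) :* (:ι 2 :* l :- :1))
      := (:ι 4 :- a :- (:ι 2 :* c) :+ (:ι 2 :* c :* l) :+ l :- (:ι 2 :* l :* l)) :* ((:1 :- l) :- c)
         :+ ((:- :1) :- c) :* ((l :* a) :- :1)
         :+ (:ι 3 :- a :- (:ι 2 :* c)) :* (((:1 :- l) :* c) :- :1)) refl l (l ⁻¹) ((1# - l) ⁻¹))

    λ⁻¹≢1-λ⁻¹ : l ⁻¹ ≢ 1# - l ⁻¹
    λ⁻¹≢1-λ⁻¹ = separated [λ+1][λ-2][2λ-1]≢0 (solve 3 (λ l a c →
      (l :+ :1) :* ((l :- :ι 2) :* (:ι 2 :* l :- :1))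
      := (l :- (l :* l) :- (:ι 2 :* l :* l :* l)) :* (a :- (:1 :- a))
         :+ ((:- :ι 2) :+ (:ι 2 :* l) :+ (:ι 4 :* l :* l)) :* ((l :* a) :- :1)
         :+ :0 :* (((:1 :- l) :* c) :- :1)) refl l (l ⁻¹) ((1# - l) ⁻¹))

    λ⁻¹≢1-[1-λ]⁻¹ : l ⁻¹ ≢ 1# - (1# - l) ⁻¹
    λ⁻¹≢1-[1-λ]⁻¹ = subst (l ⁻¹ ≢_) -[λ/[1-λ]]≡1-[1-λ]⁻¹ (separated λ²-λ+1≢0 (solve 3 (λ l a c →
      l :* l :- l :+ :1
      := (l :- (l :* l)) :* (a :- (:- (l :* c)))
         :+ ((:- :1) :+ l) :* ((l :* a) :- :1)
         :+ (:- (l :* l)) :* (((:1 :- l) :* c) :- :1)) refl l (l ⁻¹) ((1# - l) ⁻¹)))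

    λ⁻¹≢[1-λ]⁻¹ : l ⁻¹ ≢ (1# - l) ⁻¹
    λ⁻¹≢[1-λ]⁻¹ = separated [λ+1][λ-2][2λ-1]≢0 (solve 3 (λ l a c →
      (l :+ :1) :* ((l :- :ι 2) :* (:ι 2 :* l :- :1))
      := ((:ι 2 :* l) :- (l :* l) :- (:ι 2 :* l :* l :* l) :+ (l :* l :* l :* l)) :* (a :- c)
         :+ ((:- :ι 2) :+ l :+ (:ι 2 :* l :* l) :- (l :* l :* l)) :* ((l :* a) :- :1)
         :+ ((:ι 2 :* l) :+ (l :* l) :- (l :* l :* l)) :* (((:1 :- l) :* c) :- :1)) refl l (l ⁻¹) ((1# - l) ⁻¹))

    1-λ⁻¹≢1-[1-λ]⁻¹ : 1# - l ⁻¹ ≢ 1# - (1# - l) ⁻¹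
    1-λ⁻¹≢1-[1-λ]⁻¹ = subst (1# - l ⁻¹ ≢_) -[λ/[1-λ]]≡1-[1-λ]⁻¹ (separated [λ+1][λ-2][2λ-1]≢0 (solve 3 (λ l a c →
      (l :+ :1) :* ((l :- :ι 2) :* (:ι 2 :* l :- :1))
      := ((:- (:ι 2 :* l)) :+ (l :* l) :+ (:ι 2 :* l :* l :* l) :- (l :* l :* l :* l)) :* ((:1 :- a) :- (:- (l :* c)))
         :+ ((:- :ι 2) :+ l :+ (:ι 2 :* l :* l) :- (l :* l :* l)) :* ((l :* a) :- :1)
         :+ ((:ι 2 :* l :* l) :+ (l :* l :* l) :- (l :* l :* l :* l)) :* (((:1 :- l) :* c) :- :1)) refl l (l ⁻¹) ((1# - l) ⁻¹)))

    1-λ⁻¹≢[1-λ]⁻¹ : 1# - l ⁻¹ ≢ (1# - l) ⁻¹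
    1-λ⁻¹≢[1-λ]⁻¹ = separated λ²-λ+1≢0 (solve 3 (λ l a c →
      l :* l :- l :+ :1
      := ((:- l) :+ (l :* l)) :* ((:1 :- a) :- c)
         :+ ((:- :1) :+ l) :* ((l :* a) :- :1)
         :+ (:- l) :* (((:1 :- l) :* c) :- :1)) refl l (l ⁻¹) ((1# - l) ⁻¹))

    1-[1-λ]⁻¹≢[1-λ]⁻¹ : 1# - (1# - l) ⁻¹ ≢ (1# - l) ⁻¹
    1-[1-λ]⁻¹≢[1-λ]⁻¹ = subst (_≢ (1# - l) ⁻¹) -[λ/[1-λ]]≡1-[1-λ]⁻¹ (separated [λ+1][λ-2][2λ-1]≢0 (solve 3 (λ l a c →
      (l :+ :1) :* ((l :- :ι 2) :* (:ι 2 :* l :- :1))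
      := ((:- :ι 2) :+ (:ι 7 :* l) :- (:ι 7 :* l :* l) :+ (:ι 2 :* l :* l :* l)) :* ((:- (l :* c)) :- c)
         :+ :0 :* ((l :* a) :- :1)
         :+ ((:- :ι 2) :+ (:ι 3 :* l) :+ (:ι 3 :* l :* l) :- (:ι 2 :* l :* l :* l)) :* (((:1 :- l) :* c) :- :1)) refl l (l ⁻¹) ((1# - l) ⁻¹)))

module Cardinality (K : FiniteField) {l : FiniteField.F K}
                   (λ-admissible : FieldProperties.Admissible K l)
                   (j≢0 : FiniteField.jLeg K l ≢ FiniteField.0# K)
                   (j≢1728 : FiniteField.jLeg K l ≢ FiniteField.ι K 1728) where

  open FiniteField K
  open FieldProperties K
  open Counting K
  open SquareProperties K
  open EulerCriterion K (JInvariant.j≢0⇒2≢0 K l j≢0)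
  open Classification K (JInvariant.j≢0⇒2≢0 K l j≢0) λ-admissible
  open CandidatesDistinct K λ-admissible j≢0 j≢1728

  χ : F → ℕ
  χ x = indicator (IsSquare? x)

  χ-square : ∀ {x} → IsSquare x → χ x ≡ 1
  χ-square = indicator-yes (IsSquare? _)

  χ-nonsquare : ∀ {x} → ¬ IsSquare x → χ x ≡ 0
  χ-nonsquare = indicator-no (IsSquare? _)

  |L|≡1+χ[-1]+χλ+χ[-λ]+χ[1-λ]+χ[λ-1] :
    HasCard (L l) (suc (χ (- 1#) ℕ.+ ((χ l ℕ.+ χ (- l)) ℕ.+ (χ (1# - l) ℕ.+ χ (- (1# - l))))))
  |L|≡1+χ[-1]+χλ+χ[-λ]+χ[1-λ]+χ[λ-1] =
    subst (HasCard (L l)) (regroup (χ (- 1#)) (χ l) (χ (- l)) (χ (1# - l)) (χ (- (1# - l))))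
      (HasCard-⇔ (λ β → ⇔.sym (L⇔IsCandidate β)) (HasCard-candidates candidates candidates-distinct))
    where
    regroup : ∀ a b c d e → suc (a ℕ.+ (b ℕ.+ (c ℕ.+ (d ℕ.+ (e ℕ.+ 0))))) ≡ suc (a ℕ.+ ((b ℕ.+ c) ℕ.+ (d ℕ.+ e)))
    regroup a b c d e = cong (λ z → suc (a ℕ.+ z))
      (trans (sym (ℕ.+-assoc b c _)) (cong (λ z → (b ℕ.+ c) ℕ.+ (d ℕ.+ z)) (ℕ.+-identityʳ e)))

  χx+χ[-x]≡1 : size % 4 ≡ 3 → ∀ {x} → x ≢ 0# → χ x ℕ.+ χ (- x) ≡ 1
  χx+χ[-x]≡1 q≡3 {x} x≢0 = [ square , neg-square ]′ (IsSquare-or-neg-if-q≡3[4] q≡3 x≢0)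
    where
    ¬both : IsSquare x → ¬ IsSquare (- x)
    ¬both □x □-x = ¬IsSquare[-1]-if-q≡3[4] q≡3 (IsSquare-both⇒IsSquare[-1] x≢0 □x □-x)
    square : IsSquare x → χ x ℕ.+ χ (- x) ≡ 1
    square □x = cong₂ ℕ._+_ (χ-square □x) (χ-nonsquare (¬both □x))
    neg-square : IsSquare (- x) → χ x ℕ.+ χ (- x) ≡ 1
    neg-square □-x = cong₂ ℕ._+_ (χ-nonsquare (λ □x → ¬both □x □-x)) (χ-square □-x)

  χ[-x]≡χx : IsSquare (- 1#) → ∀ x → χ (- x) ≡ χ x
  χ[-x]≡χx □-1 x = indicator-cong (IsSquare? (- x)) (IsSquare? x) (IsSquare-neg⁻ □-1) (IsSquare-neg □-1)

  |L|≡3 : size % 4 ≡ 3 → HasCard (L l) 3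
  |L|≡3 q≡3 = subst (HasCard (L l)) count≡3 |L|≡1+χ[-1]+χλ+χ[-λ]+χ[1-λ]+χ[λ-1]
    where
    count≡3 : suc (χ (- 1#) ℕ.+ ((χ l ℕ.+ χ (- l)) ℕ.+ (χ (1# - l) ℕ.+ χ (- (1# - l))))) ≡ 3
    count≡3 = cong₂ (λ a b → suc (a ℕ.+ b)) (χ-nonsquare (¬IsSquare[-1]-if-q≡3[4] q≡3))
                (cong₂ ℕ._+_ (χx+χ[-x]≡1 q≡3 λ≢0) (χx+χ[-x]≡1 q≡3 1-λ≢0))

  |L|≡2[1+χλ+χ[1-λ]] : size % 4 ≡ 1 → ∀ {a b} → χ l ≡ a → χ (1# - l) ≡ b →
                        HasCard (L l) (suc (1 ℕ.+ ((a ℕ.+ a) ℕ.+ (b ℕ.+ b))))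
  |L|≡2[1+χλ+χ[1-λ]] q≡1 refl refl = subst (HasCard (L l)) count≡ |L|≡1+χ[-1]+χλ+χ[-λ]+χ[1-λ]+χ[λ-1]
    where
    □-1 : IsSquare (- 1#)
    □-1 = IsSquare[-1]-if-q≡1[4] q≡1
    count≡ : suc (χ (- 1#) ℕ.+ ((χ l ℕ.+ χ (- l)) ℕ.+ (χ (1# - l) ℕ.+ χ (- (1# - l)))))
           ≡ suc (1 ℕ.+ ((χ l ℕ.+ χ l) ℕ.+ (χ (1# - l) ℕ.+ χ (1# - l))))
    count≡ = cong₂ (λ a b → suc (a ℕ.+ b)) (χ-square □-1)
               (cong₂ ℕ._+_ (cong (χ l ℕ.+_) (χ[-x]≡χx □-1 l)) (cong (χ (1# - l) ℕ.+_) (χ[-x]≡χx □-1 (1# - l))))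

lemma2p4 : (K : FiniteField) → let open FiniteField K in
    (p k : ℕ) → Prime p → 5 ≤ p → size ≡ Data.Nat._^_ p k →
    (l : F) → l ≢ 0# → l ≢ 1# → jLeg l ≢ 0# → jLeg l ≢ ι 1728 →
    ((size % 4 ≡ 3) → HasCard (L l) 3)
    × ((size % 4 ≡ 1) → IsSquare l → IsSquare (1# - l) → HasCard (L l) 6)
    × ((size % 4 ≡ 1) → ((IsSquare l × ¬ IsSquare (1# - l)) ⊎ (¬ IsSquare l × IsSquare (1# - l))) → HasCard (L l) 4)
    × ((size % 4 ≡ 1) → ¬ IsSquare l → ¬ IsSquare (1# - l) → HasCard (L l) 2)
lemma2p4 K _ _ _ _ _ l λ≢0 λ≢1 j≢0 j≢1728 =
  |L|≡3 ,
  (λ q≡1 □λ □1-λ → |L|≡2[1+χλ+χ[1-λ]] q≡1 (χ-square □λ) (χ-square □1-λ)) ,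
  (λ q≡1 → [ (λ (□λ , ¬□1-λ) → |L|≡2[1+χλ+χ[1-λ]] q≡1 (χ-square □λ) (χ-nonsquare ¬□1-λ))
           , (λ (¬□λ , □1-λ) → |L|≡2[1+χλ+χ[1-λ]] q≡1 (χ-nonsquare ¬□λ) (χ-square □1-λ)) ]′) ,
  (λ q≡1 ¬□λ ¬□1-λ → |L|≡2[1+χλ+χ[1-λ]] q≡1 (χ-nonsquare ¬□λ) (χ-nonsquare ¬□1-λ))
  where open Cardinality K (λ≢0 , λ≢1) j≢0 j≢1728
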